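{- Let $\mathcal T,\equiv$ be a theory in deduction modulo and $A$ a formula. If $A$ is valid in all the $\mathcal B$-valued models of $\mathcal T,\equiv$ (for arbitrary truth values algebras $\mathcal B$) in which the denotation of $A$ is defined, then $\mathcal T\vdash_\equiv A$.
   Context: Deduction modulo: a theory $\mathcal T,\equiv$ consists of a set $\mathcal T$ of axioms in a (possibly many-sorted) first-order language and a congruence $\equiv$ generated by a confluent rewrite system rewriting terms to terms and atomic formulae to formulae; $\mathcal T\vdash_\equiv A$ denotes provability in intuitionistic natural deduction where every rule is applied modulo $\equiv$. Truth values algebra: a structure $\langle \mathcal B,\mathcal B^+,\mathcal A,\mathcal E,\tilde\top,\tilde\bot,\tilde\Rightarrow,\tilde\wedge,\tilde\vee,\tilde\forall,\tilde\exists\rangle$ with $\mathcal B$ a set, $\mathcal B^+\subseteq\mathcal B$, $\mathcal A,\mathcal E\subseteq\wp(\mathcal B)$, $\tilde\top,\tilde\bot\in\mathcal B$, $\tilde\Rightarrow,\tilde\wedge,\tilde\vee:\mathcal B\times\mathcal B\to\mathcal B$, $\tilde\forall:\mathcal A\to\mathcal B$, $\tilde\exists:\mathcal E\to\mathcal B$, such that for all $a,b,c\in\mathcal B$, $A\in\mathcal A$, $E\in\mathcal E$ ($\tilde\Rightarrow$ right-associative): (1) if $a\tilde\Rightarrow b\in\mathcal B^+$ and $a\in\mathcal B^+$ then $b\in\mathcal B^+$; (2) $a\tilde\Rightarrow b\tilde\Rightarrow a\in\mathcal B^+$; (3) $(a\tilde\Rightarrow b\tilde\Rightarrow c)\tilde\Rightarrow(a\tilde\Rightarrow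 b)\tilde\Rightarrow a\tilde\Rightarrow c\in\mathcal B^+$; (4) $\tilde\top\in\mathcal B^+$; (5) $\tilde\bot\tilde\Rightarrow a\in\mathcal B^+$; (6) $a\tilde\Rightarrow b\tilde\Rightarrow(a\tilde\wedge b)\in\mathcal B^+$; (7) $(a\tilde\wedge b)\tilde\Rightarrow a\in\mathcal B^+$; (8) $(a\tilde\wedge b)\tilde\Rightarrow b\in\mathcal B^+$; (9) $a\tilde\Rightarrow(a\tilde\vee b)\in\mathcal B^+$; (10) $b\tilde\Rightarrow(a\tilde\vee b)\in\mathcal B^+$; (11) $(a\tilde\vee b)\tilde\Rightarrow(a\tilde\Rightarrow c)\tilde\Rightarrow(b\tilde\Rightarrow c)\tilde\Rightarrow c\in\mathcal B^+$; (12) $\{a\tilde\Rightarrow e\mid e\in A\}\in\mathcal A$ and $\{e\tilde\Rightarrow a\mid e\in E\}\in\mathcal A$; (13) if $A\subseteq\mathcal B^+$ then $\tilde\forall A\in\mathcal B^+$; (14) $\tilde\forall\{a\tilde\Rightarrow e\mid e\in A\}\tilde\Rightarrow a\tilde\Rightarrow\tilde\forall A\in\mathcal B^+$; (15) if $a\in A$ then $(\tilde\forall A)\tilde\Rightarrow a\in\mathcal B^+$; (16) if $a\in E$ then $a\tilde\Rightarrow\tilde\exists E\in\mathcal B^+$; (17) $(\tilde\exists E)\tilde\Rightarrow\tilde\forall\{e\tilde\Rightarrow a\mid e\in E\}\tilde\Rightarrow a\in\mathcal B^+$. Models: a $\mathcal B$-valued structure has a domain $\mathcal M$ (per sort), $\hat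 f:\mathcal M^n\to\mathcal M$ for function symbols, $\hat P:\mathcal M^n\to\mathcal B$ for predicate symbols; denotation $\llbracket\cdot\rrbracket_\phi$ under an assignment $\phi$ is defined compositionally, with $\top,\bot,\Rightarrow,\wedge,\vee$ interpreted by $\tilde\top,\tilde\bot,\tilde\Rightarrow,\tilde\wedge,\tilde\vee$ and $\llbracket\forall x A\rrbracket_\phi=\tilde\forall\{\llbracket A\rrbracket_{\phi+\langle x,e\rangle}\mid e\in\mathcal M\}$, $\llbracket\exists x A\rrbracket_\phi=\tilde\exists\{\llbracket A\rrbracket_{\phi+\langle x,e\rangle}\mid e\in\mathcal M\}$ (undefined when the set is not in $\mathcal A$, resp. $\mathcal E$). A formula is valid if for every assignment its denotation is defined and lies in $\mathcal B^+$. The structure is a model of $\mathcal T,\equiv$ if all axioms are valid and whenever $A\equiv B$ (terms or formulae), for every $\phi$, $\llbracket A\rrbracket_\phi$ and $\llbracket B\rrbracket_\phi$ are defined and equal. -}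

module Defs where

open import Data.List using (List; []; _∷_; _++_; map)
open import Data.List.Relation.Unary.All using (All; []; _∷_)
open import Data.List.Membership.Propositional using (_∈_)
open import Data.Product using (Σ; _×_; _,_; ∃)
open import Data.Unit using (⊤; tt)
open import Relation.Binary.Structures using (IsEquivalence)
open import Relation.Binary.Construct.Closure.Equivalence using (EqClosure)
open import Relation.Binary.Rewriting using (Confluent)

-- A truth values algebra in the set-theoretic sense is rendered as a
-- setoid-based structure: the carrier B comes with an equivalence _≈_
-- (playing the role of equality of truth values, since Agda has no
-- quotients), and every component respects _≈_.  Subsets of B (elements
-- of ℘(B)) are predicates  B → Set ; a subset is considered up to
-- having the same elements modulo _≈_ (SameSet).

module _ {B : Set} (_≈_ : B → B → Set) where

  image : (B → B) → (B → Set) → (B → Set)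
  image f S x = ∃ λ e → S e × (x ≈ f e)

  SameSet : (B → Set) → (B → Set) → Set
  SameSet S S' = ((x : B) → S x → ∃ λ y → S' y × (x ≈ y))
               × ((y : B) → S' y → ∃ λ x → S x × (y ≈ x))

record TVA : Set₁ where
  infixr 4 _⇒̃_
  infixr 5 _∨̃_
  infixr 6 _∧̃_
  field
    Carrier : Set
    _≈_ : Carrier → Carrier → Set
    ≈-isEquivalence : IsEquivalence _≈_
    Pos : Carrier → Set                       -- membership in B⁺
    𝒜 : (Carrier → Set) → Set
    ℰ : (Carrier → Set) → Set
    ⊤̃ : Carrier
    ⊥̃ : Carrier
    _⇒̃_ : Carrier → Carrier → Carrier
    _∧̃_ : Carrier → Carrier → Carrier
    _∨̃_ : Carrier → Carrier → Carrier
    ∀̃ : (S : Carrier → Set) → 𝒜 S → Carrier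
    ∃̃ : (S : Carrier → Set) → ℰ S → Carrier
    Pos-resp : ∀ {a b} → a ≈ b → Pos a → Pos b
    ⇒̃-cong : ∀ {a a' b b'} → a ≈ a' → b ≈ b' → (a ⇒̃ b) ≈ (a' ⇒̃ b')
    ∧̃-cong : ∀ {a a' b b'} → a ≈ a' → b ≈ b' → (a ∧̃ b) ≈ (a' ∧̃ b')
    ∨̃-cong : ∀ {a a' b b'} → a ≈ a' → b ≈ b' → (a ∨̃ b) ≈ (a' ∨̃ b')
    𝒜-resp : ∀ {S S'} → SameSet _≈_ S S' → 𝒜 S → 𝒜 S'
    ℰ-resp : ∀ {S S'} → SameSet _≈_ S S' → ℰ S → ℰ S'
    ∀̃-resp : ∀ {S S'} (p : 𝒜 S) (q : 𝒜 S') → SameSet _≈_ S S' → ∀̃ S p ≈ ∀̃ S' q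
    ∃̃-resp : ∀ {S S'} (p : ℰ S) (q : ℰ S') → SameSet _≈_ S S' → ∃̃ S p ≈ ∃̃ S' q
    c1 : ∀ {a b} → Pos (a ⇒̃ b) → Pos a → Pos b
    c2 : ∀ {a b} → Pos (a ⇒̃ b ⇒̃ a)
    c3 : ∀ {a b c} → Pos ((a ⇒̃ b ⇒̃ c) ⇒̃ (a ⇒̃ b) ⇒̃ a ⇒̃ c)
    c4 : Pos ⊤̃
    c5 : ∀ {a} → Pos (⊥̃ ⇒̃ a)
    c6 : ∀ {a b} → Pos (a ⇒̃ b ⇒̃ (a ∧̃ b))
    c7 : ∀ {a b} → Pos ((a ∧̃ b) ⇒̃ a)
    c8 : ∀ {a b} → Pos ((a ∧̃ b) ⇒̃ b)
    c9 : ∀ {a b} → Pos (a ⇒̃ (a ∨̃ b))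
    c10 : ∀ {a b} → Pos (b ⇒̃ (a ∨̃ b))
    c11 : ∀ {a b c} → Pos ((a ∨̃ b) ⇒̃ (a ⇒̃ c) ⇒̃ (b ⇒̃ c) ⇒̃ c)
    c12a : ∀ a {A} → 𝒜 A → 𝒜 (image _≈_ (λ e → a ⇒̃ e) A)
    c12b : ∀ a {E} → ℰ E → 𝒜 (image _≈_ (λ e → e ⇒̃ a) E)
    c13 : ∀ {A} (p : 𝒜 A) → ((x : Carrier) → A x → Pos x) → Pos (∀̃ A p)
    c14 : ∀ {a A} (p : 𝒜 A) →
          Pos (∀̃ (image _≈_ (λ e → a ⇒̃ e) A) (c12a a p) ⇒̃ a ⇒̃ ∀̃ A p)
    c15 : ∀ {a A} (p : 𝒜 A) → A a → Pos (∀̃ A p ⇒̃ a)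
    c16 : ∀ {a E} (q : ℰ E) → E a → Pos (a ⇒̃ ∃̃ E q)
    c17 : ∀ {a E} (q : ℰ E) →
          Pos (∃̃ E q ⇒̃ ∀̃ (image _≈_ (λ e → e ⇒̃ a) E) (c12b a q) ⇒̃ a)

record Signature : Set₁ where
  field
    Sort : Set
    FunSym : Set
    PredSym : Set
    funArity : FunSym → List Sort
    funSort : FunSym → Sort
    predArity : PredSym → List Sort

data AllPW {A : Set} {P : A → Set} (R : ∀ {a} → P a → P a → Set)
     : ∀ {xs} → All P xs → All P xs → Set where
  [] : AllPW R [] []
  _∷_ : ∀ {a xs} {x y : P a} {xs' ys' : All P xs} →
        R x y → AllPW R xs' ys' → AllPW R (x ∷ xs') (y ∷ ys')

module _ (L : Signature) where
  open Signature L

  -- Well-scoped, well-sorted syntax (de Bruijn variables; a context is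
  -- the list of sorts of the free variables).
  data Var : List Sort → Sort → Set where
    here : ∀ {Γ s} → Var (s ∷ Γ) s
    there : ∀ {Γ s s'} → Var Γ s → Var (s' ∷ Γ) s

  mutual
    data Term (Γ : List Sort) : Sort → Set where
      var : ∀ {s} → Var Γ s → Term Γ s
      app : (f : FunSym) → Args Γ (funArity f) → Term Γ (funSort f)

    data Args (Γ : List Sort) : List Sort → Set where
      [] : Args Γ []
      _∷_ : ∀ {s ss} → Term Γ s → Args Γ ss → Args Γ (s ∷ ss)

  infixr 4 _⇒′_
  infixr 5 _∨′_
  infixr 6 _∧′_
  data Form (Γ : List Sort) : Set where
    atom : (P : PredSym) → Args Γ (predArity P) → Form Γ
    ⊤′ : Form Γ
    ⊥′ : Form Γ
    _⇒′_ : Form Γ → Form Γ → Form Γ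
    _∧′_ : Form Γ → Form Γ → Form Γ
    _∨′_ : Form Γ → Form Γ → Form Γ
    ∀′ : (s : Sort) → Form (s ∷ Γ) → Form Γ
    ∃′ : (s : Sort) → Form (s ∷ Γ) → Form Γ

  Ren : List Sort → List Sort → Set
  Ren Γ Δ = ∀ {s} → Var Γ s → Var Δ s

  liftRen : ∀ {Γ Δ s} → Ren Γ Δ → Ren (s ∷ Γ) (s ∷ Δ)
  liftRen ρ here = here
  liftRen ρ (there x) = there (ρ x)

  mutual
    renT : ∀ {Γ Δ s} → Ren Γ Δ → Term Γ s → Term Δ s
    renT ρ (var x) = var (ρ x)
    renT ρ (app f ts) = app f (renA ρ ts)

    renA : ∀ {Γ Δ ss} → Ren Γ Δ → Args Γ ss → Args Δ ss
    renA ρ [] = []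
    renA ρ (t ∷ ts) = renT ρ t ∷ renA ρ ts

  renF : ∀ {Γ Δ} → Ren Γ Δ → Form Γ → Form Δ
  renF ρ (atom P ts) = atom P (renA ρ ts)
  renF ρ ⊤′ = ⊤′
  renF ρ ⊥′ = ⊥′
  renF ρ (A ⇒′ B) = renF ρ A ⇒′ renF ρ B
  renF ρ (A ∧′ B) = renF ρ A ∧′ renF ρ B
  renF ρ (A ∨′ B) = renF ρ A ∨′ renF ρ B
  renF ρ (∀′ s A) = ∀′ s (renF (liftRen ρ) A)
  renF ρ (∃′ s A) = ∃′ s (renF (liftRen ρ) A)

  weaken : ∀ {Γ s} → Form Γ → Form (s ∷ Γ)
  weaken = renF there

  closedIn : ∀ {Γ} → Form [] → Form Γ
  closedIn = renF (λ ())

  extendRight : ∀ {Γ Ξ} → Ren Γ (Γ ++ Ξ)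
  extendRight here = here
  extendRight (there x) = there (extendRight x)

  Subst : List Sort → List Sort → Set
  Subst Γ Δ = ∀ {s} → Var Γ s → Term Δ s

  liftSub : ∀ {Γ Δ s} → Subst Γ Δ → Subst (s ∷ Γ) (s ∷ Δ)
  liftSub σ here = var here
  liftSub σ (there x) = renT there (σ x)

  mutual
    subT : ∀ {Γ Δ s} → Subst Γ Δ → Term Γ s → Term Δ s
    subT σ (var x) = σ x
    subT σ (app f ts) = app f (subA σ ts)

    subA : ∀ {Γ Δ ss} → Subst Γ Δ → Args Γ ss → Args Δ ss
    subA σ [] = []
    subA σ (t ∷ ts) = subT σ t ∷ subA σ ts

  subF : ∀ {Γ Δ} → Subst Γ Δ → Form Γ → Form Δ
  subF σ (atom P ts) = atom P (subA σ ts)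
  subF σ ⊤′ = ⊤′
  subF σ ⊥′ = ⊥′
  subF σ (A ⇒′ B) = subF σ A ⇒′ subF σ B
  subF σ (A ∧′ B) = subF σ A ∧′ subF σ B
  subF σ (A ∨′ B) = subF σ A ∨′ subF σ B
  subF σ (∀′ s A) = ∀′ s (subF (liftSub σ) A)
  subF σ (∃′ s A) = ∃′ s (subF (liftSub σ) A)

  sub0 : ∀ {Γ s} → Term Γ s → Subst (s ∷ Γ) Γ
  sub0 t here = t
  sub0 t (there x) = var x

  _[_]₀ : ∀ {Γ s} → Form (s ∷ Γ) → Term Γ s → Form Γ
  A [ t ]₀ = subF (sub0 t) A

  record TermRule : Set where
    field
      ctx : List Sort
      sort : Sort
      lhs : Term ctx sort
      rhs : Term ctx sort

  record PropRule : Set where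
    field
      ctx : List Sort
      pred : PredSym
      lhs : Args ctx (predArity pred)      -- the lhs is the atom  pred(lhs)
      rhs : Form ctx

  record RewriteSystem : Set₁ where
    field
      TRule : Set
      trule : TRule → TermRule
      PRule : Set
      prule : PRule → PropRule

  module _ (R : RewriteSystem) where
    open RewriteSystem R

    mutual
      data StepT : ∀ {Γ s} → Term Γ s → Term Γ s → Set where
        root : ∀ {Γ} (r : TRule) (σ : Subst (TermRule.ctx (trule r)) Γ) →
               StepT (subT σ (TermRule.lhs (trule r))) (subT σ (TermRule.rhs (trule r)))
        app : ∀ {Γ} f {ts us : Args Γ (funArity f)} → StepA ts us → StepT (app f ts) (app f us)

      data StepA : ∀ {Γ ss} → Args Γ ss → Args Γ ss → Set where
        head : ∀ {Γ s ss} {t u : Term Γ s} {ts : Args Γ ss} → StepT t u → StepA (t ∷ ts) (u ∷ ts)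
        tail : ∀ {Γ s ss} {t : Term Γ s} {ts us : Args Γ ss} → StepA ts us → StepA (t ∷ ts) (t ∷ us)

    data StepF : ∀ {Γ} → Form Γ → Form Γ → Set where
      root : ∀ {Γ} (r : PRule) (σ : Subst (PropRule.ctx (prule r)) Γ) →
             StepF (atom (PropRule.pred (prule r)) (subA σ (PropRule.lhs (prule r))))
                   (subF σ (PropRule.rhs (prule r)))
      atom : ∀ {Γ} P {ts us : Args Γ (predArity P)} → StepA ts us → StepF (atom P ts) (atom P us)
      ⇒l : ∀ {Γ} {A A' B : Form Γ} → StepF A A' → StepF (A ⇒′ B) (A' ⇒′ B)
      ⇒r : ∀ {Γ} {A B B' : Form Γ} → StepF B B' → StepF (A ⇒′ B) (A ⇒′ B')
      ∧l : ∀ {Γ} {A A' B : Form Γ} → StepF A A' → StepF (A ∧′ B) (A' ∧′ B)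
      ∧r : ∀ {Γ} {A B B' : Form Γ} → StepF B B' → StepF (A ∧′ B) (A ∧′ B')
      ∨l : ∀ {Γ} {A A' B : Form Γ} → StepF A A' → StepF (A ∨′ B) (A' ∨′ B)
      ∨r : ∀ {Γ} {A B B' : Form Γ} → StepF B B' → StepF (A ∨′ B) (A ∨′ B')
      ∀c : ∀ {Γ} s {A A' : Form (s ∷ Γ)} → StepF A A' → StepF (∀′ s A) (∀′ s A')
      ∃c : ∀ {Γ} s {A A' : Form (s ∷ Γ)} → StepF A A' → StepF (∃′ s A) (∃′ s A')

    ConvT : ∀ {Γ s} → Term Γ s → Term Γ s → Set
    ConvT {Γ} {s} = EqClosure (StepT {Γ} {s})

    ConvF : ∀ {Γ} → Form Γ → Form Γ → Set
    ConvF {Γ} = EqClosure (StepF {Γ})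

    IsConfluent : Set
    IsConfluent = (∀ Γ s → Confluent (StepT {Γ} {s})) × (∀ Γ → Confluent (StepF {Γ}))

  record Theory : Set₁ where
    field
      Axiom : Form [] → Set
      rewriting : RewriteSystem
      confluent : IsConfluent rewriting

  -- Intuitionistic natural deduction modulo ≡ (Dowek's rules).
  -- Deriv T Γ Δ A : the sequent Δ ⊢ A (hypotheses Δ, term variables Γ),
  -- where axioms of 𝒯 may also be used.
  module _ (T : Theory) where
    open Theory T
    private
      _≡f_ : ∀ {Γ} → Form Γ → Form Γ → Set
      _≡f_ = ConvF rewriting

    data Deriv : (Γ : List Sort) → List (Form Γ) → Form Γ → Set where
      ax : ∀ {Γ Δ A B} → A ∈ Δ → A ≡f B → Deriv Γ Δ B
      thy : ∀ {Γ Δ B} {A : Form []} → Axiom A → closedIn A ≡f B → Deriv Γ Δ B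
      ⊤I : ∀ {Γ Δ A} → A ≡f ⊤′ → Deriv Γ Δ A
      ⊥E : ∀ {Γ Δ A B} → Deriv Γ Δ B → B ≡f ⊥′ → Deriv Γ Δ A
      ⇒I : ∀ {Γ Δ A B C} → Deriv Γ (A ∷ Δ) B → C ≡f (A ⇒′ B) → Deriv Γ Δ C
      ⇒E : ∀ {Γ Δ A B C} → Deriv Γ Δ C → C ≡f (A ⇒′ B) → Deriv Γ Δ A → Deriv Γ Δ B
      ∧I : ∀ {Γ Δ A B C} → Deriv Γ Δ A → Deriv Γ Δ B → C ≡f (A ∧′ B) → Deriv Γ Δ C
      ∧E₁ : ∀ {Γ Δ A B C} → Deriv Γ Δ C → C ≡f (A ∧′ B) → Deriv Γ Δ A
      ∧E₂ : ∀ {Γ Δ A B C} → Deriv Γ Δ C → C ≡f (A ∧′ B) → Deriv Γ Δ B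
      ∨I₁ : ∀ {Γ Δ A B C} → Deriv Γ Δ A → C ≡f (A ∨′ B) → Deriv Γ Δ C
      ∨I₂ : ∀ {Γ Δ A B C} → Deriv Γ Δ B → C ≡f (A ∨′ B) → Deriv Γ Δ C
      ∨E : ∀ {Γ Δ A B C D} → Deriv Γ Δ C → C ≡f (A ∨′ B) →
           Deriv Γ (A ∷ Δ) D → Deriv Γ (B ∷ Δ) D → Deriv Γ Δ D
      -- x not free in the hypotheses: they are weakened
      ∀I : ∀ {Γ Δ s B} {A : Form (s ∷ Γ)} → Deriv (s ∷ Γ) (map weaken Δ) A →
           B ≡f ∀′ s A → Deriv Γ Δ B
      ∀E : ∀ {Γ Δ s B C} {A : Form (s ∷ Γ)} → Deriv Γ Δ B → B ≡f ∀′ s A →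
           (t : Term Γ s) → C ≡f (A [ t ]₀) → Deriv Γ Δ C
      ∃I : ∀ {Γ Δ s B C} {A : Form (s ∷ Γ)} → Deriv Γ Δ C → B ≡f ∃′ s A →
           (t : Term Γ s) → C ≡f (A [ t ]₀) → Deriv Γ Δ B
      -- x not free in the hypotheses nor in B
      ∃E : ∀ {Γ Δ s B C} {A : Form (s ∷ Γ)} → Deriv Γ Δ C → C ≡f ∃′ s A →
           Deriv (s ∷ Γ) (A ∷ map weaken Δ) (weaken B) → Deriv Γ Δ B

    -- 𝒯 ⊢≡ A : a derivation without hypotheses (other than axioms of 𝒯),
    -- possibly using additional free variables besides those of A.
    Provable : ∀ {Γ} → Form Γ → Set
    Provable {Γ} A = Σ (List Sort) λ Ξ → Deriv (Γ ++ Ξ) [] (renF extendRight A)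

  record Structure (𝔹 : TVA) : Set₁ where
    open TVA 𝔹
    field
      Dom : Sort → Set
      _≈ᴰ_ : ∀ {s} → Dom s → Dom s → Set
      ≈ᴰ-isEquivalence : ∀ {s} → IsEquivalence (_≈ᴰ_ {s})
      inhabited : (s : Sort) → Dom s
      fun : (f : FunSym) → All Dom (funArity f) → Dom (funSort f)
      pred : (P : PredSym) → All Dom (predArity P) → Carrier
      fun-cong : ∀ f {xs ys} → AllPW _≈ᴰ_ xs ys → fun f xs ≈ᴰ fun f ys
      pred-cong : ∀ P {xs ys} → AllPW _≈ᴰ_ xs ys → pred P xs ≈ pred P ys

  module _ {𝔹 : TVA} (M : Structure 𝔹) where
    open TVA 𝔹
    open Structure M

    lookupV : ∀ {Γ s} → Var Γ s → All Dom Γ → Dom s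
    lookupV here (e ∷ φ) = e
    lookupV (there x) (e ∷ φ) = lookupV x φ

    mutual
      ⟦_⟧t : ∀ {Γ s} → Term Γ s → All Dom Γ → Dom s
      ⟦ var x ⟧t φ = lookupV x φ
      ⟦ app f ts ⟧t φ = fun f (⟦ ts ⟧a φ)

      ⟦_⟧a : ∀ {Γ ss} → Args Γ ss → All Dom Γ → All Dom ss
      ⟦ [] ⟧a φ = []
      ⟦ t ∷ ts ⟧a φ = ⟦ t ⟧t φ ∷ ⟦ ts ⟧a φ

    mutual
      Defined : ∀ {Γ} → Form Γ → All Dom Γ → Set
      Defined (atom P ts) φ = ⊤
      Defined ⊤′ φ = ⊤
      Defined ⊥′ φ = ⊤
      Defined (A ⇒′ B) φ = Defined A φ × Defined B φ
      Defined (A ∧′ B) φ = Defined A φ × Defined B φ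
      Defined (A ∨′ B) φ = Defined A φ × Defined B φ
      Defined (∀′ s A) φ =
        Σ ((e : Dom s) → Defined A (e ∷ φ)) λ d →
          𝒜 (λ b → ∃ λ (e : Dom s) → b ≈ ⟦ A ⟧ (e ∷ φ) (d e))
      Defined (∃′ s A) φ =
        Σ ((e : Dom s) → Defined A (e ∷ φ)) λ d →
          ℰ (λ b → ∃ λ (e : Dom s) → b ≈ ⟦ A ⟧ (e ∷ φ) (d e))

      ⟦_⟧ : ∀ {Γ} (A : Form Γ) (φ : All Dom Γ) → Defined A φ → Carrier
      ⟦ atom P ts ⟧ φ _ = pred P (⟦ ts ⟧a φ)
      ⟦ ⊤′ ⟧ φ _ = ⊤̃
      ⟦ ⊥′ ⟧ φ _ = ⊥̃
      ⟦ A ⇒′ B ⟧ φ (d , d') = ⟦ A ⟧ φ d ⇒̃ ⟦ B ⟧ φ d'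
      ⟦ A ∧′ B ⟧ φ (d , d') = ⟦ A ⟧ φ d ∧̃ ⟦ B ⟧ φ d'
      ⟦ A ∨′ B ⟧ φ (d , d') = ⟦ A ⟧ φ d ∨̃ ⟦ B ⟧ φ d'
      ⟦ ∀′ s A ⟧ φ (d , p) = ∀̃ (λ b → ∃ λ (e : Dom s) → b ≈ ⟦ A ⟧ (e ∷ φ) (d e)) p
      ⟦ ∃′ s A ⟧ φ (d , p) = ∃̃ (λ b → ∃ λ (e : Dom s) → b ≈ ⟦ A ⟧ (e ∷ φ) (d e)) p

    Valid : ∀ {Γ} → Form Γ → Set
    Valid A = ∀ φ → Σ (Defined A φ) λ d → Pos (⟦ A ⟧ φ d)

    record IsModel (T : Theory) : Set where
      open Theory T
      field
        axiomsValid : ∀ (A : Form []) → Axiom A → Valid A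
        termConv : ∀ {Γ s} {t u : Term Γ s} → ConvT rewriting t u →
                   ∀ φ → ⟦ t ⟧t φ ≈ᴰ ⟦ u ⟧t φ
        formConv : ∀ {Γ} {A B : Form Γ} → ConvF rewriting A B →
                   ∀ φ → Σ (Defined A φ) λ d → Σ (Defined B φ) λ d' →
                         ⟦ A ⟧ φ d ≈ ⟦ B ⟧ φ d'

module Submission where

-- The proof builds a Lindenbaum algebra.  Extend L by fresh constants c(s,n) for every sort
-- s and every n, and by one constant for each free variable of A.  Truth values are closed
-- formulas of the extended language, positive when the L-formula obtained by turning the
-- constants back into variables is derivable in T modulo ≡; connectives are interpreted by
-- themselves, and ∀̃, ∃̃ are defined on the sets {B[t] | t} of instances of a formula B.
-- Conditions (1)-(17) are then derivable facts; the only non-trivial one is (13), where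
-- B[c] with c fresh yields ∀x B by abstracting c back into a variable.  In the model whose
-- domain is the closed terms, every formula denotes its own instance, so validity of A at
-- the assignment sending each variable to its constant gives a derivation of A.

open import Defs
open import Data.Empty using (⊥; ⊥-elim)
open import Data.Fin using (Fin; zero; suc)
open import Data.List using (List; []; _∷_; _++_; map)
open import Data.List.Membership.Propositional.Properties using (∈-map⁺)
open import Data.List.Relation.Unary.All using (All; []; _∷_)
open import Data.List.Relation.Unary.All.Properties using (++⁻)
open import Data.List.Relation.Unary.Any using (here; there)
open import Data.Nat using (ℕ; zero; suc; _<_; _⊔_)
open import Data.Nat.Properties using (<-irrefl; m≤m⊔n; m≤n⊔m; <-≤-trans)
open import Data.Product using (Σ; _×_; _,_; proj₁; proj₂; ∃; map₂)
open import Data.Sum using (_⊎_; inj₁; inj₂)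
open import Data.Unit using (tt)
open import Function using (_∘_)
open import Relation.Binary.Construct.Closure.Equivalence
  using (EqClosure; gmap; symmetric) renaming (isEquivalence to EqClosure-isEquivalence)
open import Relation.Binary.Construct.Closure.ReflexiveTransitive using (ε; _◅_; _◅◅_)
open import Relation.Binary.Construct.Closure.Symmetric using (fwd; bwd)
open import Relation.Binary.PropositionalEquality using (_≡_; refl; sym; trans; cong; cong₂; subst; subst₂; module ≡-Reasoning)
open import Relation.Nullary using (Dec; yes; no; ¬_)

module Syntax (L : Signature) where
  open Signature L

  -- Each fusion law takes the composite as an argument, specified pointwise,
  -- so that no function extensionality is needed.

  liftRen-∘ : ∀ {Γ Δ Θ s} (ρ : Ren L Δ Θ) (ρ' : Ren L Γ Δ) (ρ'' : Ren L Γ Θ) →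
              (∀ {s} (x : Var L Γ s) → ρ (ρ' x) ≡ ρ'' x) →
              ∀ {s'} (x : Var L (s ∷ Γ) s') → liftRen L ρ (liftRen L ρ' x) ≡ liftRen L ρ'' x
  liftRen-∘ ρ ρ' ρ'' h here = refl
  liftRen-∘ ρ ρ' ρ'' h (there x) = cong there (h x)

  mutual
    renT-renT : ∀ {Γ Δ Θ s} (ρ : Ren L Δ Θ) (ρ' : Ren L Γ Δ) (ρ'' : Ren L Γ Θ) →
                (∀ {s} (x : Var L Γ s) → ρ (ρ' x) ≡ ρ'' x) → (t : Term L Γ s) →
                renT L ρ (renT L ρ' t) ≡ renT L ρ'' t
    renT-renT ρ ρ' ρ'' h (var x) = cong var (h x)
    renT-renT ρ ρ' ρ'' h (app f ts) = cong (app f) (renA-renA ρ ρ' ρ'' h ts)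

    renA-renA : ∀ {Γ Δ Θ ss} (ρ : Ren L Δ Θ) (ρ' : Ren L Γ Δ) (ρ'' : Ren L Γ Θ) →
                (∀ {s} (x : Var L Γ s) → ρ (ρ' x) ≡ ρ'' x) → (ts : Args L Γ ss) →
                renA L ρ (renA L ρ' ts) ≡ renA L ρ'' ts
    renA-renA ρ ρ' ρ'' h [] = refl
    renA-renA ρ ρ' ρ'' h (t ∷ ts) = cong₂ _∷_ (renT-renT ρ ρ' ρ'' h t) (renA-renA ρ ρ' ρ'' h ts)

  renF-renF : ∀ {Γ Δ Θ} (ρ : Ren L Δ Θ) (ρ' : Ren L Γ Δ) (ρ'' : Ren L Γ Θ) →
              (∀ {s} (x : Var L Γ s) → ρ (ρ' x) ≡ ρ'' x) → (A : Form L Γ) →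
              renF L ρ (renF L ρ' A) ≡ renF L ρ'' A
  renF-renF ρ ρ' ρ'' h (atom P ts) = cong (atom P) (renA-renA ρ ρ' ρ'' h ts)
  renF-renF ρ ρ' ρ'' h ⊤′ = refl
  renF-renF ρ ρ' ρ'' h ⊥′ = refl
  renF-renF ρ ρ' ρ'' h (A ⇒′ B) = cong₂ _⇒′_ (renF-renF ρ ρ' ρ'' h A) (renF-renF ρ ρ' ρ'' h B)
  renF-renF ρ ρ' ρ'' h (A ∧′ B) = cong₂ _∧′_ (renF-renF ρ ρ' ρ'' h A) (renF-renF ρ ρ' ρ'' h B)
  renF-renF ρ ρ' ρ'' h (A ∨′ B) = cong₂ _∨′_ (renF-renF ρ ρ' ρ'' h A) (renF-renF ρ ρ' ρ'' h B)
  renF-renF ρ ρ' ρ'' h (∀′ s A) = cong (∀′ s) (renF-renF _ _ _ (liftRen-∘ ρ ρ' ρ'' h) A)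
  renF-renF ρ ρ' ρ'' h (∃′ s A) = cong (∃′ s) (renF-renF _ _ _ (liftRen-∘ ρ ρ' ρ'' h) A)

  weaken-liftRen : ∀ {Γ Δ s} (ρ : Ren L Γ Δ) (A : Form L Γ) →
                   renF L (liftRen L {s = s} ρ) (weaken L A) ≡ weaken L (renF L ρ A)
  weaken-liftRen ρ A = trans (renF-renF (liftRen L ρ) there (λ x → there (ρ x)) (λ x → refl) A)
                             (sym (renF-renF there ρ (λ x → there (ρ x)) (λ x → refl) A))

  liftSub-∘ren : ∀ {Γ Δ Θ s} (σ : Subst L Δ Θ) (ρ : Ren L Γ Δ) (σ' : Subst L Γ Θ) →
                 (∀ {s} (x : Var L Γ s) → σ (ρ x) ≡ σ' x) →
                 ∀ {s'} (x : Var L (s ∷ Γ) s') → liftSub L σ (liftRen L ρ x) ≡ liftSub L σ' x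
  liftSub-∘ren σ ρ σ' h here = refl
  liftSub-∘ren σ ρ σ' h (there x) = cong (renT L there) (h x)

  mutual
    subT-renT : ∀ {Γ Δ Θ s} (σ : Subst L Δ Θ) (ρ : Ren L Γ Δ) (σ' : Subst L Γ Θ) →
                (∀ {s} (x : Var L Γ s) → σ (ρ x) ≡ σ' x) → (t : Term L Γ s) →
                subT L σ (renT L ρ t) ≡ subT L σ' t
    subT-renT σ ρ σ' h (var x) = h x
    subT-renT σ ρ σ' h (app f ts) = cong (app f) (subA-renA σ ρ σ' h ts)

    subA-renA : ∀ {Γ Δ Θ ss} (σ : Subst L Δ Θ) (ρ : Ren L Γ Δ) (σ' : Subst L Γ Θ) →
                (∀ {s} (x : Var L Γ s) → σ (ρ x) ≡ σ' x) → (ts : Args L Γ ss) →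
                subA L σ (renA L ρ ts) ≡ subA L σ' ts
    subA-renA σ ρ σ' h [] = refl
    subA-renA σ ρ σ' h (t ∷ ts) = cong₂ _∷_ (subT-renT σ ρ σ' h t) (subA-renA σ ρ σ' h ts)

  subF-renF : ∀ {Γ Δ Θ} (σ : Subst L Δ Θ) (ρ : Ren L Γ Δ) (σ' : Subst L Γ Θ) →
              (∀ {s} (x : Var L Γ s) → σ (ρ x) ≡ σ' x) → (A : Form L Γ) →
              subF L σ (renF L ρ A) ≡ subF L σ' A
  subF-renF σ ρ σ' h (atom P ts) = cong (atom P) (subA-renA σ ρ σ' h ts)
  subF-renF σ ρ σ' h ⊤′ = refl
  subF-renF σ ρ σ' h ⊥′ = refl
  subF-renF σ ρ σ' h (A ⇒′ B) = cong₂ _⇒′_ (subF-renF σ ρ σ' h A) (subF-renF σ ρ σ' h B)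
  subF-renF σ ρ σ' h (A ∧′ B) = cong₂ _∧′_ (subF-renF σ ρ σ' h A) (subF-renF σ ρ σ' h B)
  subF-renF σ ρ σ' h (A ∨′ B) = cong₂ _∨′_ (subF-renF σ ρ σ' h A) (subF-renF σ ρ σ' h B)
  subF-renF σ ρ σ' h (∀′ s A) = cong (∀′ s) (subF-renF _ _ _ (liftSub-∘ren σ ρ σ' h) A)
  subF-renF σ ρ σ' h (∃′ s A) = cong (∃′ s) (subF-renF _ _ _ (liftSub-∘ren σ ρ σ' h) A)

  liftRen-∘sub : ∀ {Γ Δ Θ s} (ρ : Ren L Δ Θ) (σ : Subst L Γ Δ) (σ' : Subst L Γ Θ) →
                 (∀ {s} (x : Var L Γ s) → renT L ρ (σ x) ≡ σ' x) →
                 ∀ {s'} (x : Var L (s ∷ Γ) s') → renT L (liftRen L ρ) (liftSub L σ x) ≡ liftSub L σ' x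
  liftRen-∘sub ρ σ σ' h here = refl
  liftRen-∘sub ρ σ σ' h (there x) =
    trans (renT-renT (liftRen L ρ) there (λ y → there (ρ y)) (λ y → refl) (σ x))
          (trans (sym (renT-renT there ρ (λ y → there (ρ y)) (λ y → refl) (σ x)))
                 (cong (renT L there) (h x)))

  mutual
    renT-subT : ∀ {Γ Δ Θ s} (ρ : Ren L Δ Θ) (σ : Subst L Γ Δ) (σ' : Subst L Γ Θ) →
                (∀ {s} (x : Var L Γ s) → renT L ρ (σ x) ≡ σ' x) → (t : Term L Γ s) →
                renT L ρ (subT L σ t) ≡ subT L σ' t
    renT-subT ρ σ σ' h (var x) = h x
    renT-subT ρ σ σ' h (app f ts) = cong (app f) (renA-subA ρ σ σ' h ts)

    renA-subA : ∀ {Γ Δ Θ ss} (ρ : Ren L Δ Θ) (σ : Subst L Γ Δ) (σ' : Subst L Γ Θ) →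
                (∀ {s} (x : Var L Γ s) → renT L ρ (σ x) ≡ σ' x) → (ts : Args L Γ ss) →
                renA L ρ (subA L σ ts) ≡ subA L σ' ts
    renA-subA ρ σ σ' h [] = refl
    renA-subA ρ σ σ' h (t ∷ ts) = cong₂ _∷_ (renT-subT ρ σ σ' h t) (renA-subA ρ σ σ' h ts)

  renF-subF : ∀ {Γ Δ Θ} (ρ : Ren L Δ Θ) (σ : Subst L Γ Δ) (σ' : Subst L Γ Θ) →
              (∀ {s} (x : Var L Γ s) → renT L ρ (σ x) ≡ σ' x) → (A : Form L Γ) →
              renF L ρ (subF L σ A) ≡ subF L σ' A
  renF-subF ρ σ σ' h (atom P ts) = cong (atom P) (renA-subA ρ σ σ' h ts)
  renF-subF ρ σ σ' h ⊤′ = refl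
  renF-subF ρ σ σ' h ⊥′ = refl
  renF-subF ρ σ σ' h (A ⇒′ B) = cong₂ _⇒′_ (renF-subF ρ σ σ' h A) (renF-subF ρ σ σ' h B)
  renF-subF ρ σ σ' h (A ∧′ B) = cong₂ _∧′_ (renF-subF ρ σ σ' h A) (renF-subF ρ σ σ' h B)
  renF-subF ρ σ σ' h (A ∨′ B) = cong₂ _∨′_ (renF-subF ρ σ σ' h A) (renF-subF ρ σ σ' h B)
  renF-subF ρ σ σ' h (∀′ s A) = cong (∀′ s) (renF-subF _ _ _ (liftRen-∘sub ρ σ σ' h) A)
  renF-subF ρ σ σ' h (∃′ s A) = cong (∃′ s) (renF-subF _ _ _ (liftRen-∘sub ρ σ σ' h) A)

  liftSub-∘sub : ∀ {Γ Δ Θ s} (τ : Subst L Δ Θ) (σ : Subst L Γ Δ) (σ' : Subst L Γ Θ) →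
                 (∀ {s} (x : Var L Γ s) → subT L τ (σ x) ≡ σ' x) →
                 ∀ {s'} (x : Var L (s ∷ Γ) s') → subT L (liftSub L τ) (liftSub L σ x) ≡ liftSub L σ' x
  liftSub-∘sub τ σ σ' h here = refl
  liftSub-∘sub τ σ σ' h (there x) =
    trans (subT-renT (liftSub L τ) there (λ y → renT L there (τ y)) (λ y → refl) (σ x))
          (trans (sym (renT-subT there τ (λ y → renT L there (τ y)) (λ y → refl) (σ x)))
                 (cong (renT L there) (h x)))

  mutual
    subT-subT : ∀ {Γ Δ Θ s} (τ : Subst L Δ Θ) (σ : Subst L Γ Δ) (σ' : Subst L Γ Θ) →
                (∀ {s} (x : Var L Γ s) → subT L τ (σ x) ≡ σ' x) → (t : Term L Γ s) →
                subT L τ (subT L σ t) ≡ subT L σ' t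
    subT-subT τ σ σ' h (var x) = h x
    subT-subT τ σ σ' h (app f ts) = cong (app f) (subA-subA τ σ σ' h ts)

    subA-subA : ∀ {Γ Δ Θ ss} (τ : Subst L Δ Θ) (σ : Subst L Γ Δ) (σ' : Subst L Γ Θ) →
                (∀ {s} (x : Var L Γ s) → subT L τ (σ x) ≡ σ' x) → (ts : Args L Γ ss) →
                subA L τ (subA L σ ts) ≡ subA L σ' ts
    subA-subA τ σ σ' h [] = refl
    subA-subA τ σ σ' h (t ∷ ts) = cong₂ _∷_ (subT-subT τ σ σ' h t) (subA-subA τ σ σ' h ts)

  subF-subF : ∀ {Γ Δ Θ} (τ : Subst L Δ Θ) (σ : Subst L Γ Δ) (σ' : Subst L Γ Θ) →
              (∀ {s} (x : Var L Γ s) → subT L τ (σ x) ≡ σ' x) → (A : Form L Γ) →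
              subF L τ (subF L σ A) ≡ subF L σ' A
  subF-subF τ σ σ' h (atom P ts) = cong (atom P) (subA-subA τ σ σ' h ts)
  subF-subF τ σ σ' h ⊤′ = refl
  subF-subF τ σ σ' h ⊥′ = refl
  subF-subF τ σ σ' h (A ⇒′ B) = cong₂ _⇒′_ (subF-subF τ σ σ' h A) (subF-subF τ σ σ' h B)
  subF-subF τ σ σ' h (A ∧′ B) = cong₂ _∧′_ (subF-subF τ σ σ' h A) (subF-subF τ σ σ' h B)
  subF-subF τ σ σ' h (A ∨′ B) = cong₂ _∨′_ (subF-subF τ σ σ' h A) (subF-subF τ σ σ' h B)
  subF-subF τ σ σ' h (∀′ s A) = cong (∀′ s) (subF-subF _ _ _ (liftSub-∘sub τ σ σ' h) A)
  subF-subF τ σ σ' h (∃′ s A) = cong (∃′ s) (subF-subF _ _ _ (liftSub-∘sub τ σ σ' h) A)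

  liftSub-var : ∀ {Γ s} (σ : Subst L Γ Γ) → (∀ {s} (x : Var L Γ s) → σ x ≡ var x) →
                ∀ {s'} (x : Var L (s ∷ Γ) s') → liftSub L σ x ≡ var x
  liftSub-var σ h here = refl
  liftSub-var σ h (there x) = cong (renT L there) (h x)

  mutual
    subT-var : ∀ {Γ s} (σ : Subst L Γ Γ) → (∀ {s} (x : Var L Γ s) → σ x ≡ var x) →
               (t : Term L Γ s) → subT L σ t ≡ t
    subT-var σ h (var x) = h x
    subT-var σ h (app f ts) = cong (app f) (subA-var σ h ts)

    subA-var : ∀ {Γ ss} (σ : Subst L Γ Γ) → (∀ {s} (x : Var L Γ s) → σ x ≡ var x) →
               (ts : Args L Γ ss) → subA L σ ts ≡ ts
    subA-var σ h [] = refl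
    subA-var σ h (t ∷ ts) = cong₂ _∷_ (subT-var σ h t) (subA-var σ h ts)

  subF-var : ∀ {Γ} (σ : Subst L Γ Γ) → (∀ {s} (x : Var L Γ s) → σ x ≡ var x) →
             (A : Form L Γ) → subF L σ A ≡ A
  subF-var σ h (atom P ts) = cong (atom P) (subA-var σ h ts)
  subF-var σ h ⊤′ = refl
  subF-var σ h ⊥′ = refl
  subF-var σ h (A ⇒′ B) = cong₂ _⇒′_ (subF-var σ h A) (subF-var σ h B)
  subF-var σ h (A ∧′ B) = cong₂ _∧′_ (subF-var σ h A) (subF-var σ h B)
  subF-var σ h (A ∨′ B) = cong₂ _∨′_ (subF-var σ h A) (subF-var σ h B)
  subF-var σ h (∀′ s A) = cong (∀′ s) (subF-var _ (liftSub-var σ h) A)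
  subF-var σ h (∃′ s A) = cong (∃′ s) (subF-var _ (liftSub-var σ h) A)

  liftRen≗liftSub : ∀ {Γ Δ s} (ρ : Ren L Γ Δ) (σ : Subst L Γ Δ) → (∀ {s} (x : Var L Γ s) → var (ρ x) ≡ σ x) →
                    ∀ {s'} (x : Var L (s ∷ Γ) s') → var (liftRen L ρ x) ≡ liftSub L σ x
  liftRen≗liftSub ρ σ h here = refl
  liftRen≗liftSub ρ σ h (there x) = cong (renT L there) (h x)

  mutual
    renT≗subT : ∀ {Γ Δ s} (ρ : Ren L Γ Δ) (σ : Subst L Γ Δ) → (∀ {s} (x : Var L Γ s) → var (ρ x) ≡ σ x) →
                (t : Term L Γ s) → renT L ρ t ≡ subT L σ t
    renT≗subT ρ σ h (var x) = h x
    renT≗subT ρ σ h (app f ts) = cong (app f) (renA≗subA ρ σ h ts)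

    renA≗subA : ∀ {Γ Δ ss} (ρ : Ren L Γ Δ) (σ : Subst L Γ Δ) → (∀ {s} (x : Var L Γ s) → var (ρ x) ≡ σ x) →
                (ts : Args L Γ ss) → renA L ρ ts ≡ subA L σ ts
    renA≗subA ρ σ h [] = refl
    renA≗subA ρ σ h (t ∷ ts) = cong₂ _∷_ (renT≗subT ρ σ h t) (renA≗subA ρ σ h ts)

  renF≗subF : ∀ {Γ Δ} (ρ : Ren L Γ Δ) (σ : Subst L Γ Δ) → (∀ {s} (x : Var L Γ s) → var (ρ x) ≡ σ x) →
              (A : Form L Γ) → renF L ρ A ≡ subF L σ A
  renF≗subF ρ σ h (atom P ts) = cong (atom P) (renA≗subA ρ σ h ts)
  renF≗subF ρ σ h ⊤′ = refl
  renF≗subF ρ σ h ⊥′ = refl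
  renF≗subF ρ σ h (A ⇒′ B) = cong₂ _⇒′_ (renF≗subF ρ σ h A) (renF≗subF ρ σ h B)
  renF≗subF ρ σ h (A ∧′ B) = cong₂ _∧′_ (renF≗subF ρ σ h A) (renF≗subF ρ σ h B)
  renF≗subF ρ σ h (A ∨′ B) = cong₂ _∨′_ (renF≗subF ρ σ h A) (renF≗subF ρ σ h B)
  renF≗subF ρ σ h (∀′ s A) = cong (∀′ s) (renF≗subF _ _ (liftRen≗liftSub ρ σ h) A)
  renF≗subF ρ σ h (∃′ s A) = cong (∃′ s) (renF≗subF _ _ (liftRen≗liftSub ρ σ h) A)

  renF-[]₀ : ∀ {Γ Δ s} (ρ : Ren L Γ Δ) (A : Form L (s ∷ Γ)) (t : Term L Γ s) →
             renF L ρ (subF L (sub0 L t) A) ≡ subF L (sub0 L (renT L ρ t)) (renF L (liftRen L ρ) A)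
  renF-[]₀ {Γ} {Δ} {s} ρ A t =
    trans (renF-subF ρ (sub0 L t) σ onSub0 A) (sym (subF-renF (sub0 L (renT L ρ t)) (liftRen L ρ) σ onLift A))
    where
      σ : Subst L (s ∷ Γ) Δ
      σ here = renT L ρ t
      σ (there x) = var (ρ x)
      onSub0 : ∀ {s'} (x : Var L (s ∷ Γ) s') → renT L ρ (sub0 L t x) ≡ σ x
      onSub0 here = refl
      onSub0 (there x) = refl
      onLift : ∀ {s'} (x : Var L (s ∷ Γ) s') → sub0 L (renT L ρ t) (liftRen L ρ x) ≡ σ x
      onLift here = refl
      onLift (there x) = refl

  decVar : ∀ {Y s s'} (x : Var L Y s) (y : Var L Y s') → Dec (Σ (s ≡ s') λ p → subst (Var L Y) p x ≡ y)
  decVar here here = yes (refl , refl)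
  decVar here (there y) = no λ { (refl , ()) }
  decVar (there x) here = no λ { (refl , ()) }
  decVar (there x) (there y) with decVar x y
  ... | yes (refl , refl) = yes (refl , refl)
  ... | no ne = no λ { (refl , refl) → ne (refl , refl) }

  shiftBy : ∀ (Δ : List Sort) {Y s} → Var L Y s → Var L (Δ ++ Y) s
  shiftBy [] v = v
  shiftBy (s ∷ Δ) v = there (shiftBy Δ v)

  liftRenBy : ∀ (G : List Sort) {Y Y'} → (∀ {s} → Var L Y s → Var L Y' s) → ∀ {s} → Var L (G ++ Y) s → Var L (G ++ Y') s
  liftRenBy [] r = r
  liftRenBy (s ∷ G) r = liftRen L (liftRenBy G r)

  liftRenBy-extendRight : ∀ G {Y Y'} (r : ∀ {s} → Var L Y s → Var L Y' s) {s} (x : Var L G s) →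
           liftRenBy G r (extendRight L x) ≡ extendRight L x
  liftRenBy-extendRight (s ∷ G) r here = refl
  liftRenBy-extendRight (s ∷ G) r (there x) = cong there (liftRenBy-extendRight G r x)

  liftRenBy-shiftBy : ∀ G {Y Y'} (r : ∀ {s} → Var L Y s → Var L Y' s) {s} (y : Var L Y s) →
           liftRenBy G r (shiftBy G y) ≡ shiftBy G (r y)
  liftRenBy-shiftBy [] r y = refl
  liftRenBy-shiftBy (s ∷ G) r y = cong there (liftRenBy-shiftBy G r y)

  liftRenBy-∘ : ∀ G {Y Y' Y''} (r : ∀ {s} → Var L Y' s → Var L Y'' s) (r' : ∀ {s} → Var L Y s → Var L Y' s) {s}
           (x : Var L (G ++ Y) s) → liftRenBy G r (liftRenBy G r' x) ≡ liftRenBy G (λ y → r (r' y)) x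
  liftRenBy-∘ [] r r' x = refl
  liftRenBy-∘ (s ∷ G) r r' here = refl
  liftRenBy-∘ (s ∷ G) r r' (there x) = cong there (liftRenBy-∘ G r r' x)

  liftRenBy-cong : ∀ G {Y Y'} (r r' : ∀ {s} → Var L Y s → Var L Y' s) → (∀ {s} (y : Var L Y s) → r y ≡ r' y) → ∀ {s}
           (x : Var L (G ++ Y) s) → liftRenBy G r x ≡ liftRenBy G r' x
  liftRenBy-cong [] r r' h x = h x
  liftRenBy-cong (s ∷ G) r r' h here = refl
  liftRenBy-cong (s ∷ G) r r' h (there x) = cong there (liftRenBy-cong G r r' h x)

  viewVar : ∀ (G : List Sort) {Y s} (x : Var L (G ++ Y) s) →
          (Σ (Var L G s) λ g → x ≡ extendRight L g) ⊎ (Σ (Var L Y s) λ v → x ≡ shiftBy G v)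
  viewVar [] x = inj₂ (x , refl)
  viewVar (s ∷ G) here = inj₁ (here , refl)
  viewVar (s ∷ G) (there x) with viewVar G x
  ... | inj₁ (g , e) = inj₁ (there g , cong there e)
  ... | inj₂ (v , e) = inj₂ (v , cong there e)

  there-inj : ∀ {Y s s'} {x y : Var L Y s} → there {s' = s'} x ≡ there y → x ≡ y
  there-inj refl = refl

  shiftBy≢extendRight : ∀ (G : List Sort) {Y s} (v : Var L Y s) (g : Var L G s) → shiftBy G v ≡ extendRight L g → ⊥
  shiftBy≢extendRight (s ∷ G) v here ()
  shiftBy≢extendRight (s ∷ G) v (there g) e = shiftBy≢extendRight G v g (there-inj e)

  shiftBy-injective : ∀ (G : List Sort) {Y s} (a b : Var L Y s) → shiftBy G a ≡ shiftBy G b → a ≡ b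
  shiftBy-injective [] a b e = e
  shiftBy-injective (s ∷ G) a b e = shiftBy-injective G a b (there-inj e)

  subT-sub0-there : ∀ {Γ s s'} (e : Term L Γ s) (t : Term L Γ s') → subT L (sub0 L e) (renT L there t) ≡ t
  subT-sub0-there e t = trans (subT-renT (sub0 L e) there var (λ x → refl) t) (subT-var var (λ x → refl) t)

  subF-sub0-there : ∀ {Γ s} (e : Term L Γ s) (A : Form L Γ) → subF L (sub0 L e) (weaken L A) ≡ A
  subF-sub0-there e A = trans (subF-renF (sub0 L e) there var (λ x → refl) A) (subF-var var (λ x → refl) A)

  subF-sub0-here-liftRen : ∀ {Γ s} (F : Form L (s ∷ Γ)) → subF L (sub0 L (var here)) (renF L (liftRen L there) F) ≡ F
  subF-sub0-here-liftRen F = trans (subF-renF (sub0 L (var here)) (liftRen L there) var onVar F) (subF-var var (λ x → refl) F)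
    where
      onVar : ∀ {s'} (x : Var L _ s') → sub0 L (var here) (liftRen L there x) ≡ var x
      onVar here = refl
      onVar (there x) = refl

  -- Renaming u to a new innermost variable undoes the instantiation with u,
  -- provided u is not in the image of θ.
  abstract-fresh : ∀ {Δ Θ s} (θ : Ren L Δ Θ) (u : Var L Θ s) →
                   (∀ {s'} (x : Var L Δ s') → ¬ (Σ (s ≡ s') λ p → subst (Var L Θ) p u ≡ θ x)) →
                   Σ (Ren L Θ (s ∷ Θ)) λ ξ → (F : Form L (s ∷ Δ)) →
                     renF L ξ (subF L (sub0 L (var u)) (renF L (liftRen L θ) F)) ≡ renF L (liftRen L θ) F
  abstract-fresh {Δ} {Θ} {s} θ u u∉θ = ξ , λ F →
    trans (renF-subF ξ (sub0 L (var u)) _ (λ x → refl) (renF L (liftRen L θ) F))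
          (trans (subF-renF _ (liftRen L θ) (λ x → var (liftRen L θ x)) onLift F)
                 (sym (renF≗subF (liftRen L θ) _ (λ x → refl) F)))
    where
      ξ : Ren L Θ (s ∷ Θ)
      ξ z with decVar u z
      ... | yes (p , _) = subst (Var L (s ∷ Θ)) p here
      ... | no _ = there z
      onLift : ∀ {s'} (x : Var L (s ∷ Δ) s') → renT L ξ (sub0 L (var u) (liftRen L θ x)) ≡ var (liftRen L θ x)
      onLift here with decVar u u
      ... | yes (refl , _) = refl
      ... | no u≢u = ⊥-elim (u≢u (refl , refl))
      onLift (there x) with decVar u (θ x)
      ... | yes u≡θx = ⊥-elim (u∉θ x u≡θx)
      ... | no _ = refl

module Conversion (L : Signature) (R : RewriteSystem L) where
  open Signature L
  open RewriteSystem R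
  open Syntax L

  ConvA : ∀ {Γ ss} → Args L Γ ss → Args L Γ ss → Set
  ConvA = EqClosure (StepA L R)

  mutual
    StepT-sub : ∀ {Γ Δ s} (σ : Subst L Γ Δ) {t u : Term L Γ s} → StepT L R t u →
                StepT L R (subT L σ t) (subT L σ u)
    StepT-sub σ (root r σ₀) =
      subst₂ (StepT L R)
        (sym (subT-subT σ σ₀ _ (λ x → refl) (TermRule.lhs (trule r))))
        (sym (subT-subT σ σ₀ _ (λ x → refl) (TermRule.rhs (trule r))))
        (root r (λ x → subT L σ (σ₀ x)))
    StepT-sub σ (app f st) = app f (StepA-sub σ st)

    StepA-sub : ∀ {Γ Δ ss} (σ : Subst L Γ Δ) {ts us : Args L Γ ss} → StepA L R ts us →
                StepA L R (subA L σ ts) (subA L σ us)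
    StepA-sub σ (head st) = head (StepT-sub σ st)
    StepA-sub σ (tail st) = tail (StepA-sub σ st)

  StepF-sub : ∀ {Γ Δ} (σ : Subst L Γ Δ) {A B : Form L Γ} → StepF L R A B →
              StepF L R (subF L σ A) (subF L σ B)
  StepF-sub σ (root r σ₀) =
    subst₂ (StepF L R)
      (sym (cong (atom (PropRule.pred (prule r))) (subA-subA σ σ₀ _ (λ x → refl) (PropRule.lhs (prule r)))))
      (sym (subF-subF σ σ₀ _ (λ x → refl) (PropRule.rhs (prule r))))
      (root r (λ x → subT L σ (σ₀ x)))
  StepF-sub σ (atom P st) = atom P (StepA-sub σ st)
  StepF-sub σ (⇒l st) = ⇒l (StepF-sub σ st)
  StepF-sub σ (⇒r st) = ⇒r (StepF-sub σ st)
  StepF-sub σ (∧l st) = ∧l (StepF-sub σ st)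
  StepF-sub σ (∧r st) = ∧r (StepF-sub σ st)
  StepF-sub σ (∨l st) = ∨l (StepF-sub σ st)
  StepF-sub σ (∨r st) = ∨r (StepF-sub σ st)
  StepF-sub σ (∀c s st) = ∀c s (StepF-sub (liftSub L σ) st)
  StepF-sub σ (∃c s st) = ∃c s (StepF-sub (liftSub L σ) st)

  ≡⇒ConvF : ∀ {Γ} {A B : Form L Γ} → A ≡ B → ConvF L R A B
  ≡⇒ConvF refl = ε

  ConvT-sub : ∀ {Γ Δ s} (σ : Subst L Γ Δ) {t u : Term L Γ s} → ConvT L R t u →
              ConvT L R (subT L σ t) (subT L σ u)
  ConvT-sub σ = gmap (subT L σ) (StepT-sub σ)

  ConvF-sub : ∀ {Γ Δ} (σ : Subst L Γ Δ) {A B : Form L Γ} → ConvF L R A B →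
              ConvF L R (subF L σ A) (subF L σ B)
  ConvF-sub σ = gmap (subF L σ) (StepF-sub σ)

  ConvT-ren : ∀ {Γ Δ s} (ρ : Ren L Γ Δ) {t u : Term L Γ s} → ConvT L R t u →
              ConvT L R (renT L ρ t) (renT L ρ u)
  ConvT-ren ρ {t} {u} c =
    subst₂ (ConvT L R)
      (sym (renT≗subT ρ (λ x → var (ρ x)) (λ x → refl) t))
      (sym (renT≗subT ρ (λ x → var (ρ x)) (λ x → refl) u))
      (ConvT-sub (λ x → var (ρ x)) c)

  ConvA-ren : ∀ {Γ Δ ss} (ρ : Ren L Γ Δ) {ts us : Args L Γ ss} → ConvA ts us →
              ConvA (renA L ρ ts) (renA L ρ us)
  ConvA-ren ρ = gmap (renA L ρ) StepA-ren
    where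
      StepA-ren : ∀ {ss} {ts us : Args L _ ss} → StepA L R ts us → StepA L R (renA L ρ ts) (renA L ρ us)
      StepA-ren {ts = ts} {us} st =
        subst₂ (StepA L R)
          (sym (renA≗subA ρ (λ x → var (ρ x)) (λ x → refl) ts))
          (sym (renA≗subA ρ (λ x → var (ρ x)) (λ x → refl) us))
          (StepA-sub (λ x → var (ρ x)) st)

  ConvF-ren : ∀ {Γ Δ} (ρ : Ren L Γ Δ) {A B : Form L Γ} → ConvF L R A B →
              ConvF L R (renF L ρ A) (renF L ρ B)
  ConvF-ren ρ {A} {B} c =
    subst₂ (ConvF L R)
      (sym (renF≗subF ρ (λ x → var (ρ x)) (λ x → refl) A))
      (sym (renF≗subF ρ (λ x → var (ρ x)) (λ x → refl) B))
      (ConvF-sub (λ x → var (ρ x)) c)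

module Derivations (L : Signature) (T : Theory L) where
  open Signature L
  open Theory T
  open Syntax L
  open Conversion L rewriting

  map-weaken-liftRen : ∀ {Γ Δ s} (ρ : Ren L Γ Δ) (Hs : List (Form L Γ)) →
                       map (renF L (liftRen L {s = s} ρ)) (map (weaken L) Hs) ≡ map (weaken L) (map (renF L ρ) Hs)
  map-weaken-liftRen ρ [] = refl
  map-weaken-liftRen ρ (A ∷ Hs) = cong₂ _∷_ (weaken-liftRen ρ A) (map-weaken-liftRen ρ Hs)

  Deriv-ren : ∀ {Γ Δ Hs A} (ρ : Ren L Γ Δ) → Deriv L T Γ Hs A → Deriv L T Δ (map (renF L ρ) Hs) (renF L ρ A)
  Deriv-ren ρ (ax m c) = ax (∈-map⁺ (renF L ρ) m) (ConvF-ren ρ c)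
  Deriv-ren ρ (thy {B = B} {A = A} a c) =
    thy a (subst (λ X → ConvF L rewriting X (renF L ρ B)) (renF-renF ρ (λ ()) (λ ()) (λ ()) A) (ConvF-ren ρ c))
  Deriv-ren ρ (⊤I c) = ⊤I (ConvF-ren ρ c)
  Deriv-ren ρ (⊥E d c) = ⊥E (Deriv-ren ρ d) (ConvF-ren ρ c)
  Deriv-ren ρ (⇒I d c) = ⇒I (Deriv-ren ρ d) (ConvF-ren ρ c)
  Deriv-ren ρ (⇒E d c d') = ⇒E (Deriv-ren ρ d) (ConvF-ren ρ c) (Deriv-ren ρ d')
  Deriv-ren ρ (∧I d d' c) = ∧I (Deriv-ren ρ d) (Deriv-ren ρ d') (ConvF-ren ρ c)
  Deriv-ren ρ (∧E₁ d c) = ∧E₁ (Deriv-ren ρ d) (ConvF-ren ρ c)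
  Deriv-ren ρ (∧E₂ d c) = ∧E₂ (Deriv-ren ρ d) (ConvF-ren ρ c)
  Deriv-ren ρ (∨I₁ d c) = ∨I₁ (Deriv-ren ρ d) (ConvF-ren ρ c)
  Deriv-ren ρ (∨I₂ d c) = ∨I₂ (Deriv-ren ρ d) (ConvF-ren ρ c)
  Deriv-ren ρ (∨E d c d₁ d₂) = ∨E (Deriv-ren ρ d) (ConvF-ren ρ c) (Deriv-ren ρ d₁) (Deriv-ren ρ d₂)
  Deriv-ren {Hs = Hs} ρ (∀I d c) =
    ∀I (subst (λ H → Deriv L T _ H _) (map-weaken-liftRen ρ Hs) (Deriv-ren (liftRen L ρ) d)) (ConvF-ren ρ c)
  Deriv-ren ρ (∀E {C = C} {A = A} d c t c') =
    ∀E (Deriv-ren ρ d) (ConvF-ren ρ c) (renT L ρ t)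
       (subst (ConvF L rewriting (renF L ρ C)) (renF-[]₀ ρ A t) (ConvF-ren ρ c'))
  Deriv-ren ρ (∃I {C = C} {A = A} d c t c') =
    ∃I (Deriv-ren ρ d) (ConvF-ren ρ c) (renT L ρ t)
       (subst (ConvF L rewriting (renF L ρ C)) (renF-[]₀ ρ A t) (ConvF-ren ρ c'))
  Deriv-ren {Hs = Hs} ρ (∃E {B = B} {A = A} d c d') =
    ∃E (Deriv-ren ρ d) (ConvF-ren ρ c)
       (subst₂ (λ H X → Deriv L T _ H X) (cong (_ ∷_) (map-weaken-liftRen ρ Hs)) (weaken-liftRen ρ B)
               (Deriv-ren (liftRen L ρ) d'))

  module _ {Γ : List Sort} where
    hyp₀ : ∀ {A Hs} → Deriv L T Γ (A ∷ Hs) A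
    hyp₀ = ax (here refl) ε
    hyp₁ : ∀ {A B Hs} → Deriv L T Γ (B ∷ A ∷ Hs) A
    hyp₁ = ax (there (here refl)) ε
    hyp₂ : ∀ {A B C Hs} → Deriv L T Γ (C ∷ B ∷ A ∷ Hs) A
    hyp₂ = ax (there (there (here refl))) ε
    hyp₃ : ∀ {A B C D Hs} → Deriv L T Γ (D ∷ C ∷ B ∷ A ∷ Hs) A
    hyp₃ = ax (there (there (there (here refl)))) ε
    lam : ∀ {A B Hs} → Deriv L T Γ (A ∷ Hs) B → Deriv L T Γ Hs (A ⇒′ B)
    lam d = ⇒I d ε
    app⇒ : ∀ {A B Hs} → Deriv L T Γ Hs (A ⇒′ B) → Deriv L T Γ Hs A → Deriv L T Γ Hs B
    app⇒ d d' = ⇒E d ε d'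

-- Propositional schemas: a tautology derived once for arbitrary L-formulas transfers to
-- every instantiation by L⁺-formulas (schema-derivable).
module Schemas where
  infixr 4 _s⇒_
  infixr 5 _s∨_
  infixr 6 _s∧_
  data Schema (k : ℕ) : Set where
    pvar : Fin k → Schema k
    s⊤ s⊥ : Schema k
    _s⇒_ _s∧_ _s∨_ : Schema k → Schema k → Schema k

  ⟪_⟫ : ∀ {L : Signature} {k Δ} → Schema k → (Fin k → Form L Δ) → Form L Δ
  ⟪ pvar i ⟫ v = v i
  ⟪ s⊤ ⟫ v = ⊤′
  ⟪ s⊥ ⟫ v = ⊥′
  ⟪ A s⇒ B ⟫ v = ⟪ A ⟫ v ⇒′ ⟪ B ⟫ v
  ⟪ A s∧ B ⟫ v = ⟪ A ⟫ v ∧′ ⟪ B ⟫ v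
  ⟪ A s∨ B ⟫ v = ⟪ A ⟫ v ∨′ ⟪ B ⟫ v

  v1 : ∀ {A : Set} → A → Fin 1 → A
  v1 a zero = a
  v2 : ∀ {A : Set} → A → A → Fin 2 → A
  v2 a b zero = a
  v2 a b (suc zero) = b
  v3 : ∀ {A : Set} → A → A → A → Fin 3 → A
  v3 a b c zero = a
  v3 a b c (suc zero) = b
  v3 a b c (suc (suc zero)) = c
  v4 : ∀ {A : Set} → A → A → A → A → Fin 4 → A
  v4 a b c d zero = a
  v4 a b c d (suc zero) = b
  v4 a b c d (suc (suc zero)) = c
  v4 a b c d (suc (suc (suc zero))) = d

  p₀ : ∀ {k} → Schema (suc k)
  p₀ = pvar zero
  p₁ : ∀ {k} → Schema (suc (suc k))
  p₁ = pvar (suc zero)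
  p₂ : ∀ {k} → Schema (suc (suc (suc k)))
  p₂ = pvar (suc (suc zero))
  p₃ : ∀ {k} → Schema (suc (suc (suc (suc k))))
  p₃ = pvar (suc (suc (suc zero)))

module ExtendedLanguage (L : Signature) (Γ : List (Signature.Sort L)) where
  open Signature L
  open Syntax L

  -- The language of the Lindenbaum algebra: L with a generic constant c(s,n) of each
  -- sort s for every n, and a constant for each free variable of Γ.
  Const : Set
  Const = Σ Sort (λ s → ℕ ⊎ Var L Γ s)

  L⁺ : Signature
  L⁺ = record { Sort = Sort ; FunSym = FunSym ⊎ Const ; PredSym = PredSym
              ; funArity = arity⁺ ; funSort = sort⁺ ; predArity = predArity }
    where
      arity⁺ : FunSym ⊎ Const → List Sort
      arity⁺ (inj₁ f) = funArity f
      arity⁺ (inj₂ _) = []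
      sort⁺ : FunSym ⊎ Const → Sort
      sort⁺ (inj₁ f) = funSort f
      sort⁺ (inj₂ c) = proj₁ c

  generic : ∀ {Δ} s → ℕ → Term L⁺ Δ s
  generic s n = app (inj₂ (s , inj₁ n)) []

  param : ∀ {Δ s} → Var L Γ s → Term L⁺ Δ s
  param {s = s} x = app (inj₂ (s , inj₂ x)) []

  toVar : ∀ {Δ s} → Var L⁺ Δ s → Var L Δ s
  toVar here = here
  toVar (there x) = there (toVar x)

  toVar⁺ : ∀ {Δ s} → Var L Δ s → Var L⁺ Δ s
  toVar⁺ here = here
  toVar⁺ (there x) = there (toVar⁺ x)

  toVar-toVar⁺ : ∀ {Δ s} (x : Var L Δ s) → toVar (toVar⁺ x) ≡ x
  toVar-toVar⁺ here = refl
  toVar-toVar⁺ (there x) = cong there (toVar-toVar⁺ x)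

  -- A naming chooses fresh variables for finitely many generic constants: the variable v
  -- stands for c(s, index v).  Two variables may share an index; merging identifies them.
  record Naming : Set where
    constructor naming
    field
      vars : List Sort
      index : ∀ {s} → Var L vars s → ℕ
  open Naming

  ctx : Naming → List Sort
  ctx W = Γ ++ vars W

  bounded : ∀ (Y : List Sort) (f : ∀ {s} → Var L Y s → ℕ) → Σ ℕ λ k → ∀ {s} (v : Var L Y s) → f v < k
  bounded [] f = 0 , λ ()
  bounded (s ∷ Y) f with bounded Y (λ v → f (there v))
  ... | k , h = (suc (f here) ⊔ k) , below
    where
      below : ∀ {s'} (v : Var L (s ∷ Y) s') → f v < suc (f here) ⊔ k
      below here = m≤m⊔n (suc (f here)) k
      below (there v) = <-≤-trans (h v) (m≤n⊔m (suc (f here)) k)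

  -- TrF W Δ A F: the L-formula F is A with its constants replaced by variables, the
  -- generic ones as named by W and c(x) by x itself; Δ are the bound variables.
  mutual
    data TrT (W : Naming) (Δ : List Sort) : ∀ {s} → Term L⁺ Δ s → Term L (Δ ++ ctx W) s → Set where
      tvar : ∀ {s} (x : Var L⁺ Δ s) → TrT W Δ (var x) (var (extendRight L (toVar x)))
      tfun : ∀ (f : FunSym) {ts us} → TrA W Δ ts us → TrT W Δ (app (inj₁ f) ts) (app f us)
      tgeneric : ∀ {s} n (v : Var L (vars W) s) → index W v ≡ n → TrT W Δ (generic s n) (var (shiftBy Δ (shiftBy Γ v)))
      tparam : ∀ {s} (x : Var L Γ s) → TrT W Δ (param x) (var (shiftBy Δ (extendRight L x)))

    data TrA (W : Naming) (Δ : List Sort) : ∀ {ss} → Args L⁺ Δ ss → Args L (Δ ++ ctx W) ss → Set where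
      [] : TrA W Δ [] []
      _∷_ : ∀ {s ss} {t : Term L⁺ Δ s} {u} {ts : Args L⁺ Δ ss} {us} → TrT W Δ t u → TrA W Δ ts us → TrA W Δ (t ∷ ts) (u ∷ us)

  data TrF (W : Naming) : (Δ : List Sort) → Form L⁺ Δ → Form L (Δ ++ ctx W) → Set where
    tatom : ∀ {Δ} P {ts us} → TrA W Δ ts us → TrF W Δ (atom P ts) (atom P us)
    t⊤ : ∀ {Δ} → TrF W Δ ⊤′ ⊤′
    t⊥ : ∀ {Δ} → TrF W Δ ⊥′ ⊥′
    t⇒ : ∀ {Δ A A' B B'} → TrF W Δ A A' → TrF W Δ B B' → TrF W Δ (A ⇒′ B) (A' ⇒′ B')
    t∧ : ∀ {Δ A A' B B'} → TrF W Δ A A' → TrF W Δ B B' → TrF W Δ (A ∧′ B) (A' ∧′ B')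
    t∨ : ∀ {Δ A A' B B'} → TrF W Δ A A' → TrF W Δ B B' → TrF W Δ (A ∨′ B) (A' ∨′ B')
    t∀ : ∀ {Δ} s {A A'} → TrF W (s ∷ Δ) A A' → TrF W Δ (∀′ s A) (∀′ s A')
    t∃ : ∀ {Δ} s {A A'} → TrF W (s ∷ Δ) A A' → TrF W Δ (∃′ s A) (∃′ s A')

  record Mor (W W' : Naming) : Set where
    constructor mor
    field
      vmap : ∀ {s} → Var L (vars W) s → Var L (vars W') s
      vmap-index : ∀ {s} (v : Var L (vars W) s) → index W' (vmap v) ≡ index W v
  open Mor

  _∘M_ : ∀ {W₁ W₂ W₃} → Mor W₂ W₃ → Mor W₁ W₂ → Mor W₁ W₃
  m ∘M m' = mor (λ v → vmap m (vmap m' v)) (λ v → trans (vmap-index m (vmap m' v)) (vmap-index m' v))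

  varsRen : ∀ Δ {Y Y'} → (∀ {s} → Var L Y s → Var L Y' s) → ∀ {s} → Var L (Δ ++ Γ ++ Y) s → Var L (Δ ++ Γ ++ Y') s
  varsRen Δ r = liftRenBy Δ (liftRenBy Γ r)

  varsRen-bound : ∀ Δ {Y Y'} (r : ∀ {s} → Var L Y s → Var L Y' s) {s} (x : Var L Δ s) →
                  varsRen Δ r (extendRight L x) ≡ extendRight L x
  varsRen-bound Δ r x = liftRenBy-extendRight Δ _ x

  varsRen-param : ∀ Δ {Y Y'} (r : ∀ {s} → Var L Y s → Var L Y' s) {s} (x : Var L Γ s) →
                  varsRen Δ r (shiftBy Δ (extendRight L x)) ≡ shiftBy Δ (extendRight L x)
  varsRen-param Δ r x = trans (liftRenBy-shiftBy Δ _ (extendRight L x)) (cong (shiftBy Δ) (liftRenBy-extendRight Γ r x))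

  varsRen-vars : ∀ Δ {Y Y'} (r : ∀ {s} → Var L Y s → Var L Y' s) {s} (v : Var L Y s) →
                 varsRen Δ r (shiftBy Δ (shiftBy Γ v)) ≡ shiftBy Δ (shiftBy Γ (r v))
  varsRen-vars Δ r v = trans (liftRenBy-shiftBy Δ _ (shiftBy Γ v)) (cong (shiftBy Δ) (liftRenBy-shiftBy Γ r v))

  varsRen-∘ : ∀ Δ {Y Y' Y''} (r : ∀ {s} → Var L Y' s → Var L Y'' s) (r' : ∀ {s} → Var L Y s → Var L Y' s) {s}
              (x : Var L (Δ ++ Γ ++ Y) s) → varsRen Δ r (varsRen Δ r' x) ≡ varsRen Δ (λ y → r (r' y)) x
  varsRen-∘ Δ r r' x = trans (liftRenBy-∘ Δ (liftRenBy Γ r) (liftRenBy Γ r') x)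
                             (liftRenBy-cong Δ _ _ (liftRenBy-∘ Γ r r') x)

  morRen : ∀ Δ {W W'} → Mor W W' → ∀ {s} → Var L (Δ ++ ctx W) s → Var L (Δ ++ ctx W') s
  morRen Δ m = varsRen Δ (vmap m)

  fresh-∉-morRen : ∀ {W W' s n} (m : Mor W W') (v : Var L (vars W') s) → index W' v ≡ n →
                   (∀ {s'} (w : Var L (vars W) s') → index W w < n) →
                   ∀ {s'} (x : Var L (ctx W) s') →
                   ¬ (Σ (s ≡ s') λ p → subst (Var L (ctx W')) p (shiftBy Γ v) ≡ morRen [] m x)
  fresh-∉-morRen {W} {W'} {n = n} m v v↦n below x (refl , v≡mx) with viewVar Γ x
  ... | inj₁ (g , refl) = shiftBy≢extendRight Γ v g (trans v≡mx (liftRenBy-extendRight Γ (vmap m) g))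
  ... | inj₂ (w , refl) = <-irrefl w↦n (below w)
    where
      w↦n : index W w ≡ n
      w↦n = trans (sym (vmap-index m w))
                  (trans (cong (index W') (sym (shiftBy-injective Γ _ _ (trans v≡mx (liftRenBy-shiftBy Γ (vmap m) w))))) v↦n)

  mutual
    TrT-mor : ∀ {W W'} (m : Mor W W') {Δ s} {t : Term L⁺ Δ s} {u} → TrT W Δ t u → TrT W' Δ t (renT L (morRen Δ m) u)
    TrT-mor m {Δ} (tvar x) = subst (λ z → TrT _ _ (var x) (var z)) (sym (varsRen-bound Δ (vmap m) (toVar x))) (tvar x)
    TrT-mor m (tfun f d) = tfun f (TrA-mor m d)
    TrT-mor m {Δ} (tgeneric n v e) =
      subst (λ z → TrT _ _ (generic _ n) (var z)) (sym (varsRen-vars Δ (vmap m) v)) (tgeneric n (vmap m v) (trans (vmap-index m v) e))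
    TrT-mor m {Δ} (tparam x) = subst (λ z → TrT _ _ (param x) (var z)) (sym (varsRen-param Δ (vmap m) x)) (tparam x)

    TrA-mor : ∀ {W W'} (m : Mor W W') {Δ ss} {t : Args L⁺ Δ ss} {u} → TrA W Δ t u → TrA W' Δ t (renA L (morRen Δ m) u)
    TrA-mor m [] = []
    TrA-mor m (d ∷ ds) = TrT-mor m d ∷ TrA-mor m ds

  TrF-mor : ∀ {W W'} (m : Mor W W') {Δ} {t : Form L⁺ Δ} {u} → TrF W Δ t u → TrF W' Δ t (renF L (morRen Δ m) u)
  TrF-mor m (tatom P d) = tatom P (TrA-mor m d)
  TrF-mor m t⊤ = t⊤
  TrF-mor m t⊥ = t⊥
  TrF-mor m (t⇒ a b) = t⇒ (TrF-mor m a) (TrF-mor m b)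
  TrF-mor m (t∧ a b) = t∧ (TrF-mor m a) (TrF-mor m b)
  TrF-mor m (t∨ a b) = t∨ (TrF-mor m a) (TrF-mor m b)
  TrF-mor m (t∀ s a) = t∀ s (TrF-mor m a)
  TrF-mor m (t∃ s a) = t∃ s (TrF-mor m a)

  record ImplementsRen (W : Naming) {Δ Δ'} (ρ : Ren L⁺ Δ Δ') (r : Ren L (Δ ++ ctx W) (Δ' ++ ctx W)) : Set where
    field
      ren-bound : ∀ {s} (x : Var L⁺ Δ s) → r (extendRight L (toVar x)) ≡ extendRight L (toVar (ρ x))
      ren-ctx : ∀ {s} (y : Var L (ctx W) s) → r (shiftBy Δ y) ≡ shiftBy Δ' y
  open ImplementsRen

  ImplementsRen-lift : ∀ {W Δ Δ' s} {ρ : Ren L⁺ Δ Δ'} {r : Ren L (Δ ++ ctx W) (Δ' ++ ctx W)} → ImplementsRen W ρ r →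
               ImplementsRen W (liftRen L⁺ {s = s} ρ) (liftRen L r)
  ren-bound (ImplementsRen-lift sp) here = refl
  ren-bound (ImplementsRen-lift sp) (there x) = cong there (ren-bound sp x)
  ren-ctx (ImplementsRen-lift sp) y = cong there (ren-ctx sp y)

  ImplementsRen-weaken : ∀ {W Δ s} → ImplementsRen W {Δ} {s ∷ Δ} there there
  ren-bound ImplementsRen-weaken x = refl
  ren-ctx ImplementsRen-weaken y = refl

  mutual
    TrT-ren : ∀ {W Δ Δ' s} {ρ : Ren L⁺ Δ Δ'} {r : Ren L (Δ ++ ctx W) (Δ' ++ ctx W)} → ImplementsRen W ρ r →
              {t : Term L⁺ Δ s} {u : Term L (Δ ++ ctx W) s} → TrT W Δ t u → TrT W Δ' (renT L⁺ ρ t) (renT L r u)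
    TrT-ren {ρ = ρ} sp (tvar x) = subst (λ z → TrT _ _ (var (ρ x)) (var z)) (sym (ren-bound sp x)) (tvar (ρ x))
    TrT-ren sp (tfun f d) = tfun f (TrA-ren sp d)
    TrT-ren sp (tgeneric n v e) = subst (λ z → TrT _ _ (generic _ n) (var z)) (sym (ren-ctx sp (shiftBy Γ v))) (tgeneric n v e)
    TrT-ren sp (tparam x) = subst (λ z → TrT _ _ (param x) (var z)) (sym (ren-ctx sp (extendRight L x))) (tparam x)

    TrA-ren : ∀ {W Δ Δ' ss} {ρ : Ren L⁺ Δ Δ'} {r : Ren L (Δ ++ ctx W) (Δ' ++ ctx W)} → ImplementsRen W ρ r →
              {t : Args L⁺ Δ ss} {u : Args L (Δ ++ ctx W) ss} → TrA W Δ t u → TrA W Δ' (renA L⁺ ρ t) (renA L r u)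
    TrA-ren sp [] = []
    TrA-ren sp (d ∷ ds) = TrT-ren sp d ∷ TrA-ren sp ds

  TrF-ren : ∀ {W Δ Δ'} {ρ : Ren L⁺ Δ Δ'} {r : Ren L (Δ ++ ctx W) (Δ' ++ ctx W)} → ImplementsRen W ρ r →
            {t : Form L⁺ Δ} {u : Form L (Δ ++ ctx W)} → TrF W Δ t u → TrF W Δ' (renF L⁺ ρ t) (renF L r u)
  TrF-ren sp (tatom P d) = tatom P (TrA-ren sp d)
  TrF-ren sp t⊤ = t⊤
  TrF-ren sp t⊥ = t⊥
  TrF-ren sp (t⇒ a b) = t⇒ (TrF-ren sp a) (TrF-ren sp b)
  TrF-ren sp (t∧ a b) = t∧ (TrF-ren sp a) (TrF-ren sp b)
  TrF-ren sp (t∨ a b) = t∨ (TrF-ren sp a) (TrF-ren sp b)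
  TrF-ren sp (t∀ s a) = t∀ s (TrF-ren (ImplementsRen-lift sp) a)
  TrF-ren sp (t∃ s a) = t∃ s (TrF-ren (ImplementsRen-lift sp) a)

  record ImplementsSub (W : Naming) {Δ Δ'} (σ : Subst L⁺ Δ Δ') (τ : Subst L (Δ ++ ctx W) (Δ' ++ ctx W)) : Set where
    field
      sub-bound : ∀ {s} (x : Var L⁺ Δ s) → TrT W Δ' (σ x) (τ (extendRight L (toVar x)))
      sub-ctx : ∀ {s} (y : Var L (ctx W) s) → τ (shiftBy Δ y) ≡ var (shiftBy Δ' y)
  open ImplementsSub

  ImplementsSub-lift : ∀ {W Δ Δ' s} {σ : Subst L⁺ Δ Δ'} {τ : Subst L (Δ ++ ctx W) (Δ' ++ ctx W)} → ImplementsSub W σ τ →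
               ImplementsSub W (liftSub L⁺ {s = s} σ) (liftSub L τ)
  sub-bound (ImplementsSub-lift sp) here = tvar here
  sub-bound (ImplementsSub-lift sp) (there x) = TrT-ren ImplementsRen-weaken (sub-bound sp x)
  sub-ctx (ImplementsSub-lift sp) y = cong (renT L there) (sub-ctx sp y)

  mutual
    TrT-sub : ∀ {W Δ Δ' s} {σ : Subst L⁺ Δ Δ'} {τ : Subst L (Δ ++ ctx W) (Δ' ++ ctx W)} → ImplementsSub W σ τ →
              {t : Term L⁺ Δ s} {u : Term L (Δ ++ ctx W) s} → TrT W Δ t u → TrT W Δ' (subT L⁺ σ t) (subT L τ u)
    TrT-sub sp (tvar x) = sub-bound sp x
    TrT-sub sp (tfun f d) = tfun f (TrA-sub sp d)
    TrT-sub sp (tgeneric n v e) = subst (TrT _ _ (generic _ n)) (sym (sub-ctx sp (shiftBy Γ v))) (tgeneric n v e)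
    TrT-sub sp (tparam x) = subst (TrT _ _ (param x)) (sym (sub-ctx sp (extendRight L x))) (tparam x)

    TrA-sub : ∀ {W Δ Δ' ss} {σ : Subst L⁺ Δ Δ'} {τ : Subst L (Δ ++ ctx W) (Δ' ++ ctx W)} → ImplementsSub W σ τ →
              {t : Args L⁺ Δ ss} {u : Args L (Δ ++ ctx W) ss} → TrA W Δ t u → TrA W Δ' (subA L⁺ σ t) (subA L τ u)
    TrA-sub sp [] = []
    TrA-sub sp (d ∷ ds) = TrT-sub sp d ∷ TrA-sub sp ds

  TrF-sub : ∀ {W Δ Δ'} {σ : Subst L⁺ Δ Δ'} {τ : Subst L (Δ ++ ctx W) (Δ' ++ ctx W)} → ImplementsSub W σ τ →
            {t : Form L⁺ Δ} {u : Form L (Δ ++ ctx W)} → TrF W Δ t u → TrF W Δ' (subF L⁺ σ t) (subF L τ u)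
  TrF-sub sp (tatom P d) = tatom P (TrA-sub sp d)
  TrF-sub sp t⊤ = t⊤
  TrF-sub sp t⊥ = t⊥
  TrF-sub sp (t⇒ a b) = t⇒ (TrF-sub sp a) (TrF-sub sp b)
  TrF-sub sp (t∧ a b) = t∧ (TrF-sub sp a) (TrF-sub sp b)
  TrF-sub sp (t∨ a b) = t∨ (TrF-sub sp a) (TrF-sub sp b)
  TrF-sub sp (t∀ s a) = t∀ s (TrF-sub (ImplementsSub-lift sp) a)
  TrF-sub sp (t∃ s a) = t∃ s (TrF-sub (ImplementsSub-lift sp) a)

module Readings (L : Signature) (Γ : List (Signature.Sort L)) where
  open Signature L
  open Syntax L
  open ExtendedLanguage L Γ
  open Naming
  open Mor

  emptyNaming : Naming
  emptyNaming = naming [] (λ ())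

  singleNaming : Sort → ℕ → Naming
  singleNaming s n = naming (s ∷ []) λ { here → n }

  splitVar : ∀ (Y : List Sort) {Z s} → Var L (Y ++ Z) s → Var L Y s ⊎ Var L Z s
  splitVar [] v = inj₂ v
  splitVar (s ∷ Y) here = inj₁ here
  splitVar (s ∷ Y) (there v) with splitVar Y v
  ... | inj₁ a = inj₁ (there a)
  ... | inj₂ b = inj₂ b

  splitVar-extendRight : ∀ Y {Z s} (y : Var L Y s) → splitVar Y {Z} (extendRight L y) ≡ inj₁ y
  splitVar-extendRight (s ∷ Y) here = refl
  splitVar-extendRight (s ∷ Y) {Z} (there y) rewrite splitVar-extendRight Y {Z} y = refl

  splitVar-shiftBy : ∀ Y {Z s} (z : Var L Z s) → splitVar Y (shiftBy Y z) ≡ inj₂ z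
  splitVar-shiftBy [] z = refl
  splitVar-shiftBy (s ∷ Y) z rewrite splitVar-shiftBy Y z = refl

  indexSum : ∀ (W₁ W₂ : Naming) {s} → Var L (vars W₁) s ⊎ Var L (vars W₂) s → ℕ
  indexSum W₁ W₂ (inj₁ a) = index W₁ a
  indexSum W₁ W₂ (inj₂ b) = index W₂ b

  _⊕_ : Naming → Naming → Naming
  W₁ ⊕ W₂ = naming (vars W₁ ++ vars W₂) (λ v → indexSum W₁ W₂ (splitVar (vars W₁) v))

  inlMor : ∀ {W₁ W₂} → Mor W₁ (W₁ ⊕ W₂)
  inlMor {W₁} {W₂} = mor (extendRight L) (λ v → cong (indexSum W₁ W₂) (splitVar-extendRight (vars W₁) v))

  inrMor : ∀ {W₁ W₂} → Mor W₂ (W₁ ⊕ W₂)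
  inrMor {W₁} {W₂} = mor (shiftBy (vars W₁)) (λ v → cong (indexSum W₁ W₂) (splitVar-shiftBy (vars W₁) v))

  extend : Naming → Sort → ℕ → Naming
  extend W s n = W ⊕ singleNaming s n

  newVar : ∀ W s n → Var L (vars (extend W s n)) s
  newVar W s n = vmap (inrMor {W} {singleNaming s n}) here

  newVar-index : ∀ W s n → index (extend W s n) (newVar W s n) ≡ n
  newVar-index W s n = vmap-index (inrMor {W} {singleNaming s n}) here

  mutual
    readT : ∀ {Δ s} (t : Term L⁺ Δ s) → Σ Naming (λ W → Σ (Term L (Δ ++ ctx W) s) (TrT W Δ t))
    readT (var x) = emptyNaming , _ , tvar x
    readT (app (inj₁ f) ts) with readA ts
    ... | W , us , d = W , app f us , tfun f d
    readT (app (inj₂ (s , inj₁ n)) []) = singleNaming s n , _ , tgeneric n here refl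
    readT (app (inj₂ (s , inj₂ x)) []) = emptyNaming , _ , tparam x

    readA : ∀ {Δ ss} (ts : Args L⁺ Δ ss) → Σ Naming (λ W → Σ (Args L (Δ ++ ctx W) ss) (TrA W Δ ts))
    readA [] = emptyNaming , [] , []
    readA (t ∷ ts) with readT t | readA ts
    ... | W₁ , u , d1 | W₂ , us , d2 = (W₁ ⊕ W₂) , _ , (TrT-mor inlMor d1 ∷ TrA-mor inrMor d2)

  readF : ∀ {Δ} (A : Form L⁺ Δ) → Σ Naming (λ W → Σ (Form L (Δ ++ ctx W)) (TrF W Δ A))
  readF (atom P ts) with readA ts
  ... | W , us , d = W , atom P us , tatom P d
  readF ⊤′ = emptyNaming , ⊤′ , t⊤
  readF ⊥′ = emptyNaming , ⊥′ , t⊥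
  readF (A ⇒′ B) with readF A | readF B
  ... | W₁ , _ , d1 | W₂ , _ , d2 = (W₁ ⊕ W₂) , _ , t⇒ (TrF-mor inlMor d1) (TrF-mor inrMor d2)
  readF (A ∧′ B) with readF A | readF B
  ... | W₁ , _ , d1 | W₂ , _ , d2 = (W₁ ⊕ W₂) , _ , t∧ (TrF-mor inlMor d1) (TrF-mor inrMor d2)
  readF (A ∨′ B) with readF A | readF B
  ... | W₁ , _ , d1 | W₂ , _ , d2 = (W₁ ⊕ W₂) , _ , t∨ (TrF-mor inlMor d1) (TrF-mor inrMor d2)
  readF (∀′ s A) with readF A
  ... | W , _ , d = W , _ , t∀ s d
  readF (∃′ s A) with readF A
  ... | W , _ , d = W , _ , t∃ s d

  readFF : ∀ {Δ Δ'} (A : Form L⁺ Δ) (B : Form L⁺ Δ') →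
           Σ Naming λ W → Σ (Form L (Δ ++ ctx W)) (TrF W Δ A) × Σ (Form L (Δ' ++ ctx W)) (TrF W Δ' B)
  readFF A B with readF A | readF B
  ... | W₁ , _ , dA | W₂ , _ , dB = W₁ ⊕ W₂ , (_ , TrF-mor inlMor dA) , (_ , TrF-mor inrMor dB)

  readFT : ∀ {Δ Δ' s} (A : Form L⁺ Δ) (t : Term L⁺ Δ' s) →
           Σ Naming λ W → Σ (Form L (Δ ++ ctx W)) (TrF W Δ A) × Σ (Term L (Δ' ++ ctx W) s) (TrT W Δ' t)
  readFT A t with readF A | readT t
  ... | W₁ , _ , dA | W₂ , _ , dt = W₁ ⊕ W₂ , (_ , TrF-mor inlMor dA) , (_ , TrT-mor inrMor dt)

  readFs : ∀ {k} (as : Fin k → Form L⁺ []) → Σ Naming λ W → Σ (Fin k → Form L (ctx W)) λ Fs → ∀ i → TrF W [] (as i) (Fs i)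
  readFs {zero} as = emptyNaming , (λ ()) , (λ ())
  readFs {suc k} as with readF (as zero) | readFs (λ i → as (suc i))
  ... | W₁ , F₁ , d₁ | W₂ , Fs , ds = (W₁ ⊕ W₂) , Fs' , ds'
    where
      Fs' : Fin (suc k) → Form L (ctx (W₁ ⊕ W₂))
      Fs' zero = renF L (morRen [] (inlMor {W₁} {W₂})) F₁
      Fs' (suc i) = renF L (morRen [] (inrMor {W₁} {W₂})) (Fs i)
      ds' : ∀ i → TrF (W₁ ⊕ W₂) [] (as i) (Fs' i)
      ds' zero = TrF-mor (inlMor {W₁} {W₂}) d₁
      ds' (suc i) = TrF-mor (inrMor {W₁} {W₂}) (ds i)

  -- Two readings of one formula differ only in which variables stand for each generic
  -- constant; a clash records two such variables, which must be identified.
  Clash : Naming → Set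
  Clash W = Σ Sort λ s → Σ (Var L (vars W) s) λ u → Σ (Var L (vars W) s) λ v → index W u ≡ index W v

  VarMap : Naming → Set
  VarMap W = ∀ {s} → Var L (vars W) s → Var L (vars W) s

  Identifies : ∀ {W} → VarMap W → Clash W → Set
  Identifies rep (s , u , v , _) = rep u ≡ rep v

  mutual
    clashesT : ∀ {W Δ s} {t : Term L⁺ Δ s} {u u'} → TrT W Δ t u → TrT W Δ t u' → List (Clash W)
    clashesT (tvar x) (tvar .x) = []
    clashesT (tfun f d) (tfun .f d') = clashesA d d'
    clashesT (tgeneric n v e) (tgeneric .n v' e') = (_ , v , v' , trans e (sym e')) ∷ []
    clashesT (tparam x) (tparam .x) = []

    clashesA : ∀ {W Δ ss} {t : Args L⁺ Δ ss} {u u'} → TrA W Δ t u → TrA W Δ t u' → List (Clash W)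
    clashesA [] [] = []
    clashesA (d ∷ ds) (d' ∷ ds') = clashesT d d' ++ clashesA ds ds'

  clashesF : ∀ {W Δ} {t : Form L⁺ Δ} {u u'} → TrF W Δ t u → TrF W Δ t u' → List (Clash W)
  clashesF (tatom P d) (tatom .P d') = clashesA d d'
  clashesF t⊤ t⊤ = []
  clashesF t⊥ t⊥ = []
  clashesF (t⇒ a b) (t⇒ a' b') = clashesF a a' ++ clashesF b b'
  clashesF (t∧ a b) (t∧ a' b') = clashesF a a' ++ clashesF b b'
  clashesF (t∨ a b) (t∨ a' b') = clashesF a a' ++ clashesF b b'
  clashesF (t∀ s a) (t∀ .s a') = clashesF a a'
  clashesF (t∃ s a) (t∃ .s a') = clashesF a a'

  mutual
    readingsT-agree : ∀ {W Δ s} (rep : VarMap W) {t : Term L⁺ Δ s} {u u'} (d : TrT W Δ t u) (d' : TrT W Δ t u') →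
                      All (Identifies rep) (clashesT d d') → renT L (varsRen Δ rep) u ≡ renT L (varsRen Δ rep) u'
    readingsT-agree rep (tvar x) (tvar .x) _ = refl
    readingsT-agree rep (tfun f d) (tfun .f d') ids = cong (app f) (readingsA-agree rep d d' ids)
    readingsT-agree {Δ = Δ} rep (tgeneric n v e) (tgeneric .n v' e') (v~v' ∷ []) =
      cong var (trans (varsRen-vars Δ rep v) (trans (cong (λ z → shiftBy Δ (shiftBy Γ z)) v~v') (sym (varsRen-vars Δ rep v'))))
    readingsT-agree rep (tparam x) (tparam .x) _ = refl

    readingsA-agree : ∀ {W Δ ss} (rep : VarMap W) {t : Args L⁺ Δ ss} {u u'} (d : TrA W Δ t u) (d' : TrA W Δ t u') →
                      All (Identifies rep) (clashesA d d') → renA L (varsRen Δ rep) u ≡ renA L (varsRen Δ rep) u'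
    readingsA-agree rep [] [] _ = refl
    readingsA-agree rep (d ∷ ds) (d' ∷ ds') ids with ++⁻ (clashesT d d') ids
    ... | ids₁ , ids₂ = cong₂ _∷_ (readingsT-agree rep d d' ids₁) (readingsA-agree rep ds ds' ids₂)

  readingsF-agree : ∀ {W Δ} (rep : VarMap W) {t : Form L⁺ Δ} {u u'} (d : TrF W Δ t u) (d' : TrF W Δ t u') →
                    All (Identifies rep) (clashesF d d') → renF L (varsRen Δ rep) u ≡ renF L (varsRen Δ rep) u'
  readingsF-agree rep (tatom P d) (tatom .P d') ids = cong (atom P) (readingsA-agree rep d d' ids)
  readingsF-agree rep t⊤ t⊤ _ = refl
  readingsF-agree rep t⊥ t⊥ _ = refl
  readingsF-agree rep (t⇒ a b) (t⇒ a' b') ids with ++⁻ (clashesF a a') ids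
  ... | ids₁ , ids₂ = cong₂ _⇒′_ (readingsF-agree rep a a' ids₁) (readingsF-agree rep b b' ids₂)
  readingsF-agree rep (t∧ a b) (t∧ a' b') ids with ++⁻ (clashesF a a') ids
  ... | ids₁ , ids₂ = cong₂ _∧′_ (readingsF-agree rep a a' ids₁) (readingsF-agree rep b b' ids₂)
  readingsF-agree rep (t∨ a b) (t∨ a' b') ids with ++⁻ (clashesF a a') ids
  ... | ids₁ , ids₂ = cong₂ _∨′_ (readingsF-agree rep a a' ids₁) (readingsF-agree rep b b' ids₂)
  readingsF-agree rep (t∀ s a) (t∀ .s a') ids = cong (∀′ s) (readingsF-agree rep a a' ids)
  readingsF-agree rep (t∃ s a) (t∃ .s a') ids = cong (∃′ s) (readingsF-agree rep a a' ids)

  module Unification (W : Naming) where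
    IndexPreserving : VarMap W → Set
    IndexPreserving rep = ∀ {s} (v : Var L (vars W) s) → index W (rep v) ≡ index W v

    redirect : VarMap W → Clash W → VarMap W
    redirect rep (s , u , v , e) z with decVar (rep v) z
    ... | yes (p , q) = subst (Var L (vars W)) p (rep u)
    ... | no _ = z

    redirect-index : (rep : VarMap W) → IndexPreserving rep → (c : Clash W) →
                     ∀ {s} (z : Var L (vars W) s) → index W (redirect rep c z) ≡ index W z
    redirect-index rep pres (s , u , v , e) z with decVar (rep v) z
    ... | yes (refl , refl) = trans (pres u) (trans e (sym (pres v)))
    ... | no _ = refl

    redirect-identifies : (rep : VarMap W) (c : Clash W) → Identifies (λ z → redirect rep c (rep z)) c
    redirect-identifies rep (s , u , v , e) = trans onU (sym onV)
      where
        onV : redirect rep (s , u , v , e) (rep v) ≡ rep u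
        onV with decVar (rep v) (rep v)
        ... | yes (refl , _) = refl
        ... | no ne = ⊥-elim (ne (refl , refl))
        onU : redirect rep (s , u , v , e) (rep u) ≡ rep u
        onU with decVar (rep v) (rep u)
        ... | yes (refl , _) = refl
        ... | no _ = refl

    redirect-keeps : (rep : VarMap W) (c : Clash W) (cs : List (Clash W)) →
                     All (Identifies rep) cs → All (Identifies (λ z → redirect rep c (rep z))) cs
    redirect-keeps rep c [] [] = []
    redirect-keeps rep c (_ ∷ cs) (h ∷ hs) = cong (redirect rep c) h ∷ redirect-keeps rep c cs hs

    unifier : (cs : List (Clash W)) → Σ (VarMap W) λ rep → IndexPreserving rep × All (Identifies rep) cs
    unifier [] = (λ v → v) , (λ v → refl) , []
    unifier (c ∷ cs) with unifier cs
    ... | rep , pres , ids =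
      (λ z → redirect rep c (rep z)) ,
      (λ z → trans (redirect-index rep pres c (rep z)) (pres z)) ,
      (redirect-identifies rep c ∷ redirect-keeps rep c cs ids)

  merge : ∀ {W₁ W₂ Δ} {A : Form L⁺ Δ} {F₁ F₂} → TrF W₁ Δ A F₁ → TrF W₂ Δ A F₂ →
          Σ Naming λ W → Σ (Mor W₁ W) λ m₁ → Σ (Mor W₂ W) λ m₂ → renF L (morRen Δ m₁) F₁ ≡ renF L (morRen Δ m₂) F₂
  merge {W₁} {W₂} {Δ} {A} {F₁} {F₂} d₁ d₂
    with Unification.unifier (W₁ ⊕ W₂) (clashesF (TrF-mor (inlMor {W₁} {W₂}) d₁) (TrF-mor (inrMor {W₁} {W₂}) d₂))
  ... | rep , pres , ids = W₁ ⊕ W₂ , unify ∘M inl , unify ∘M inr , agree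
    where
      inl : Mor W₁ (W₁ ⊕ W₂)
      inl = inlMor
      inr : Mor W₂ (W₁ ⊕ W₂)
      inr = inrMor
      unify : Mor (W₁ ⊕ W₂) (W₁ ⊕ W₂)
      unify = mor rep pres
      agree : renF L (morRen Δ (unify ∘M inl)) F₁ ≡ renF L (morRen Δ (unify ∘M inr)) F₂
      agree = begin
        renF L (morRen Δ (unify ∘M inl)) F₁                 ≡⟨ renF-renF _ _ _ (varsRen-∘ Δ rep (vmap inl)) F₁ ⟨
        renF L (varsRen Δ rep) (renF L (morRen Δ inl) F₁)   ≡⟨ readingsF-agree rep (TrF-mor inl d₁) (TrF-mor inr d₂) ids ⟩
        renF L (varsRen Δ rep) (renF L (morRen Δ inr) F₂)   ≡⟨ renF-renF _ _ _ (varsRen-∘ Δ rep (vmap inr)) F₂ ⟩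
        renF L (morRen Δ (unify ∘M inr)) F₂                 ∎
        where open ≡-Reasoning

module Derivability (L : Signature) (T : Theory L) (Γ : List (Signature.Sort L)) where
  open Signature L
  open Theory T renaming (rewriting to R)
  open Syntax L
  open Conversion L R
  open Derivations L T
  open ExtendedLanguage L Γ
  open Readings L Γ
  open Naming
  open Mor
  open Schemas
  module Syn⁺ = Syntax L⁺

  Derivable : Form L⁺ [] → Set
  Derivable c = Σ Naming λ W → Σ (Form L (ctx W)) λ F → TrF W [] c F × Deriv L T (ctx W) [] F

  Derivable-mp : ∀ {a b} → Derivable (a ⇒′ b) → Derivable a → Derivable b
  Derivable-mp (W₁ , _ , t⇒ da db , D₁) (W₂ , _ , da' , D₂) with merge da da'
  ... | W , m₁ , m₂ , agree =
    W , _ , TrF-mor m₁ db ,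
    app⇒ (Deriv-ren (morRen [] m₁) D₁) (subst (Deriv L T _ []) (sym agree) (Deriv-ren (morRen [] m₂) D₂))

  TrF-schema : ∀ {k W} (S : Schema k) {as : Fin k → Form L⁺ []} {Fs : Fin k → Form L (ctx W)} →
          (∀ i → TrF W [] (as i) (Fs i)) → TrF W [] (⟪ S ⟫ as) (⟪ S ⟫ Fs)
  TrF-schema (pvar i) ds = ds i
  TrF-schema s⊤ ds = t⊤
  TrF-schema s⊥ ds = t⊥
  TrF-schema (A s⇒ B) ds = t⇒ (TrF-schema A ds) (TrF-schema B ds)
  TrF-schema (A s∧ B) ds = t∧ (TrF-schema A ds) (TrF-schema B ds)
  TrF-schema (A s∨ B) ds = t∨ (TrF-schema A ds) (TrF-schema B ds)

  schema-derivable : ∀ {k} (S : Schema k) → (∀ {D} (Fs : Fin k → Form L D) → Deriv L T D [] (⟪ S ⟫ Fs)) →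
         (as : Fin k → Form L⁺ []) → Derivable (⟪ S ⟫ as)
  schema-derivable S D as with readFs as
  ... | W , Fs , ds = W , ⟪ S ⟫ Fs , TrF-schema S ds , D Fs

  Derivable-mp₂ : ∀ {a b c} → Derivable (a ⇒′ b ⇒′ c) → Derivable a → Derivable b → Derivable c
  Derivable-mp₂ p q r = Derivable-mp (Derivable-mp p q) r

  Carrier : Set
  Carrier = Form L⁺ []

  _≈_ : Carrier → Carrier → Set
  a ≈ b = Derivable (a ⇒′ b) × Derivable (b ⇒′ a)

  ⇒-refl : ∀ a → Derivable (a ⇒′ a)
  ⇒-refl a = schema-derivable (p₀ s⇒ p₀) (λ Fs → lam hyp₀) (v1 a)

  ⇒-trans : ∀ {a b c} → Derivable (a ⇒′ b) → Derivable (b ⇒′ c) → Derivable (a ⇒′ c)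
  ⇒-trans {a} {b} {c} = Derivable-mp₂ (schema-derivable ((p₀ s⇒ p₁) s⇒ (p₁ s⇒ p₂) s⇒ (p₀ s⇒ p₂))
                                         (λ Fs → lam (lam (lam (app⇒ hyp₁ (app⇒ hyp₂ hyp₀))))) (v3 a b c))

  ⇒-flip : ∀ {a b c} → Derivable (a ⇒′ b ⇒′ c) → Derivable (b ⇒′ a ⇒′ c)
  ⇒-flip {a} {b} {c} = Derivable-mp (schema-derivable ((p₀ s⇒ p₁ s⇒ p₂) s⇒ p₁ s⇒ p₀ s⇒ p₂)
                                       (λ Fs → lam (lam (lam (app⇒ (app⇒ hyp₂ hyp₀) hyp₁)))) (v3 a b c))

  ≈refl : ∀ {a} → a ≈ a
  ≈refl {a} = ⇒-refl a , ⇒-refl a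

  ≈sym : ∀ {a b} → a ≈ b → b ≈ a
  ≈sym (p , q) = q , p

  ≈trans : ∀ {a b c} → a ≈ b → b ≈ c → a ≈ c
  ≈trans (p , q) (p' , q') = ⇒-trans p p' , ⇒-trans q' q

  Derivable-resp : ∀ {a b} → a ≈ b → Derivable a → Derivable b
  Derivable-resp (p , _) = Derivable-mp p

  ⇒-mono : ∀ a b a' b' → Derivable ((a' ⇒′ a) ⇒′ (b ⇒′ b') ⇒′ (a ⇒′ b) ⇒′ (a' ⇒′ b'))
  ⇒-mono a b a' b' = schema-derivable ((p₂ s⇒ p₀) s⇒ (p₁ s⇒ p₃) s⇒ (p₀ s⇒ p₁) s⇒ (p₂ s⇒ p₃))
                       (λ Fs → lam (lam (lam (lam (app⇒ hyp₂ (app⇒ hyp₁ (app⇒ hyp₃ hyp₀))))))) (v4 a b a' b')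

  ∧-mono : ∀ a b a' b' → Derivable ((a ⇒′ a') ⇒′ (b ⇒′ b') ⇒′ (a ∧′ b) ⇒′ (a' ∧′ b'))
  ∧-mono a b a' b' = schema-derivable ((p₀ s⇒ p₂) s⇒ (p₁ s⇒ p₃) s⇒ (p₀ s∧ p₁) s⇒ (p₂ s∧ p₃))
                       (λ Fs → lam (lam (lam (∧I (app⇒ hyp₂ (∧E₁ hyp₀ ε)) (app⇒ hyp₁ (∧E₂ hyp₀ ε)) ε)))) (v4 a b a' b')

  ∨-mono : ∀ a b a' b' → Derivable ((a ⇒′ a') ⇒′ (b ⇒′ b') ⇒′ (a ∨′ b) ⇒′ (a' ∨′ b'))
  ∨-mono a b a' b' = schema-derivable ((p₀ s⇒ p₂) s⇒ (p₁ s⇒ p₃) s⇒ (p₀ s∨ p₁) s⇒ (p₂ s∨ p₃))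
                       (λ Fs → lam (lam (lam (∨E hyp₀ ε (∨I₁ (app⇒ hyp₃ hyp₀) ε) (∨I₂ (app⇒ hyp₂ hyp₀) ε))))) (v4 a b a' b')

  ⇒cong : ∀ {a a' b b'} → a ≈ a' → b ≈ b' → (a ⇒′ b) ≈ (a' ⇒′ b')
  ⇒cong {a} {a'} {b} {b'} (a⇒a' , a'⇒a) (b⇒b' , b'⇒b) =
    Derivable-mp₂ (⇒-mono a b a' b') a'⇒a b⇒b' , Derivable-mp₂ (⇒-mono a' b' a b) a⇒a' b'⇒b

  ∧cong : ∀ {a a' b b'} → a ≈ a' → b ≈ b' → (a ∧′ b) ≈ (a' ∧′ b')
  ∧cong {a} {a'} {b} {b'} (a⇒a' , a'⇒a) (b⇒b' , b'⇒b) =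
    Derivable-mp₂ (∧-mono a b a' b') a⇒a' b⇒b' , Derivable-mp₂ (∧-mono a' b' a b) a'⇒a b'⇒b

  ∨cong : ∀ {a a' b b'} → a ≈ a' → b ≈ b' → (a ∨′ b) ≈ (a' ∨′ b')
  ∨cong {a} {a'} {b} {b'} (a⇒a' , a'⇒a) (b⇒b' , b'⇒b) =
    Derivable-mp₂ (∨-mono a b a' b') a⇒a' b⇒b' , Derivable-mp₂ (∨-mono a' b' a b) a'⇒a b'⇒b

  _[_]' : ∀ {s} → Form L⁺ (s ∷ []) → Term L⁺ [] s → Carrier
  B [ e ]' = subF L⁺ (sub0 L⁺ e) B

  ImplementsSub-sub0 : ∀ {W s} (e : Term L⁺ [] s) (te : Term L (ctx W) s) → TrT W [] e te →
             ImplementsSub W (sub0 L⁺ e) (sub0 L te)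
  ImplementsSub.sub-bound (ImplementsSub-sub0 e te d) here = d
  ImplementsSub.sub-ctx (ImplementsSub-sub0 e te d) y = refl

  ∀-instance : ∀ {s} (B : Form L⁺ (s ∷ [])) (e : Term L⁺ [] s) → Derivable (∀′ s B ⇒′ B [ e ]')
  ∀-instance {s} B e with readFT B e
  ... | W , (_ , dB) , (_ , de) = W , _ , t⇒ (t∀ s dB) (TrF-sub (ImplementsSub-sub0 e _ de) dB) , lam (∀E hyp₀ ε _ ε)

  ∃-instance : ∀ {s} (B : Form L⁺ (s ∷ [])) (e : Term L⁺ [] s) → Derivable (B [ e ]' ⇒′ ∃′ s B)
  ∃-instance {s} B e with readFT B e
  ... | W , (_ , dB) , (_ , de) = W , _ , t⇒ (TrF-sub (ImplementsSub-sub0 e _ de) dB) (t∃ s dB) , lam (∃I hyp₀ ε _ ε)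

  ∀-⇒-pull : ∀ {s} (a : Carrier) (B : Form L⁺ (s ∷ [])) → Derivable (∀′ s (weaken L⁺ a ⇒′ B) ⇒′ a ⇒′ ∀′ s B)
  ∀-⇒-pull {s} a B with readFF a B
  ... | W , (_ , da) , (_ , dB) =
    W , _ , t⇒ (t∀ s (t⇒ (TrF-ren ImplementsRen-weaken da) dB)) (t⇒ da (t∀ s dB)) ,
    lam (lam (∀I (app⇒ (∀E hyp₁ ε (var here) (≡⇒ConvF (sym (subF-sub0-here-liftRen _)))) hyp₀) ε))

  ∃-⇒-elim : ∀ {s} (a : Carrier) (B : Form L⁺ (s ∷ [])) → Derivable (∃′ s B ⇒′ ∀′ s (B ⇒′ weaken L⁺ a) ⇒′ a)
  ∃-⇒-elim {s} a B with readFF a B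
  ... | W , (_ , da) , (_ , dB) =
    W , _ , t⇒ (t∃ s dB) (t⇒ (t∀ s (t⇒ dB (TrF-ren ImplementsRen-weaken da))) da) ,
    lam (lam (∃E hyp₁ ε (app⇒ (∀E hyp₁ ε (var here) (≡⇒ConvF (sym (subF-sub0-here-liftRen _)))) hyp₀)))

  TrF-generic-instance : ∀ {s WB FB n} {B : Form L⁺ (s ∷ [])} → TrF WB (s ∷ []) B FB →
                         TrF (extend WB s n) [] (B [ generic s n ]')
                             (subF L (sub0 L (var (shiftBy Γ (newVar WB s n)))) (renF L (morRen (s ∷ []) (inlMor {WB} {singleNaming s n})) FB))
  TrF-generic-instance {s} {WB} {n = n} dB = TrF-sub instₙ (TrF-mor inlMor dB)
    where
      instₙ : ImplementsSub (extend WB s n) (sub0 L⁺ (generic s n)) (sub0 L (var (shiftBy Γ (newVar WB s n))))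
      ImplementsSub.sub-bound instₙ here = tgeneric n (newVar WB s n) (newVar-index WB s n)
      ImplementsSub.sub-bound instₙ (there ())
      ImplementsSub.sub-ctx instₙ y = refl

  -- To derive ∀x B from B[c(s,n)] with c(s,n) fresh for B, read both over a common
  -- naming; there the variable u standing for c(s,n) is fresh, so it can be abstracted.
  generalize : ∀ {s WB FB} {B : Form L⁺ (s ∷ [])} → TrF WB (s ∷ []) B FB →
               ∀ {n} → (∀ {s'} (v : Var L (vars WB) s') → index WB v < n) →
               Derivable (B [ generic s n ]') → Derivable (∀′ s B)
  generalize {s} {WB} {FB} dB {n} below (W₁ , F₁ , d₁ , D₁) with merge d₁ (TrF-generic-instance dB)
  ... | W , m₁ , m₂ , agree =
    W , _ , t∀ s (TrF-mor mB dB) , ∀I (subst (Deriv L T _ []) (proj₂ abstracted FB) (Deriv-ren (proj₁ abstracted) Dᵤ)) ε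
    where
      inl : Mor WB (extend WB s n)
      inl = inlMor
      xₙ : Var L (vars (extend WB s n)) s
      xₙ = newVar WB s n
      mB : Mor WB W
      mB = m₂ ∘M inl
      u : Var L (ctx W) s
      u = shiftBy Γ (vmap m₂ xₙ)
      G : Form L (s ∷ ctx W)
      G = renF L (liftRen L (morRen [] mB)) FB
      moved : renF L (morRen [] m₂) (subF L (sub0 L (var (shiftBy Γ xₙ))) (renF L (liftRen L (morRen [] inl)) FB))
              ≡ subF L (sub0 L (var u)) G
      moved = trans (renF-[]₀ (morRen [] m₂) _ (var (shiftBy Γ xₙ)))
                    (cong₂ (λ t F → subF L (sub0 L t) F) (cong var (liftRenBy-shiftBy Γ (vmap m₂) xₙ))
                           (renF-renF _ _ _ (liftRen-∘ _ _ _ (liftRenBy-∘ Γ (vmap m₂) (vmap inl))) FB))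
      Dᵤ : Deriv L T (ctx W) [] (subF L (sub0 L (var u)) G)
      Dᵤ = subst (Deriv L T (ctx W) []) (trans agree moved) (Deriv-ren (morRen [] m₁) D₁)
      abstracted : Σ (Ren L (ctx W) (s ∷ ctx W)) λ ξ → (F : Form L (s ∷ ctx WB)) →
                     renF L ξ (subF L (sub0 L (var u)) (renF L (liftRen L (morRen [] mB)) F)) ≡ renF L (liftRen L (morRen [] mB)) F
      abstracted = abstract-fresh (morRen [] mB) u
                     (fresh-∉-morRen mB (vmap m₂ xₙ) (trans (vmap-index m₂ xₙ) (newVar-index WB s n)) below)

module LindenbaumAlgebra (L : Signature) (T : Theory L) (Γ : List (Signature.Sort L)) where
  open Signature L
  open Theory T renaming (rewriting to R)
  open Syntax L
  open Derivations L T
  open ExtendedLanguage L Γ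
  open Readings L Γ
  open Derivability L T Γ
  open Schemas
  open Naming

  Instances : ∀ {s} → Form L⁺ (s ∷ []) → Carrier → Set
  Instances {s} B x = Σ (Term L⁺ [] s) λ e → x ≈ (B [ e ]')

  IsInstanceSet : (Carrier → Set) → Set
  IsInstanceSet S = Σ Sort λ s → Σ (Form L⁺ (s ∷ [])) λ B → SameSet _≈_ S (Instances B)

  ∀̃ : (S : Carrier → Set) → IsInstanceSet S → Carrier
  ∀̃ S (s , B , _) = ∀′ s B

  ∃̃ : (S : Carrier → Set) → IsInstanceSet S → Carrier
  ∃̃ S (s , B , _) = ∃′ s B

  SameSet-sym : ∀ {S₁ S₂ : Carrier → Set} → SameSet _≈_ S₁ S₂ → SameSet _≈_ S₂ S₁
  SameSet-sym (f , g) = g , f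

  SameSet-trans : ∀ {S₁ S₂ S₃ : Carrier → Set} → SameSet _≈_ S₁ S₂ → SameSet _≈_ S₂ S₃ → SameSet _≈_ S₁ S₃
  SameSet-trans {S₁} {S₂} {S₃} (f₁ , g₁) (f₂ , g₂) = fw , bw
    where
      fw : (x : Carrier) → S₁ x → ∃ λ z → S₃ z × (x ≈ z)
      fw x x∈ with f₁ x x∈
      ... | y , y∈ , x≈y with f₂ y y∈
      ... | z , z∈ , y≈z = z , z∈ , ≈trans x≈y y≈z
      bw : (z : Carrier) → S₃ z → ∃ λ x → S₁ x × (z ≈ x)
      bw z z∈ with g₂ z z∈
      ... | y , y∈ , z≈y with g₁ y y∈
      ... | x , x∈ , y≈x = x , x∈ , ≈trans z≈y y≈x

  IsInstanceSet-resp : ∀ {S S₂} → SameSet _≈_ S S₂ → IsInstanceSet S → IsInstanceSet S₂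
  IsInstanceSet-resp SS (s , B , ss) = s , B , SameSet-trans (SameSet-sym SS) ss

  Derivable-∀I : ∀ {s} (C : Form L⁺ (s ∷ [])) → ((n : ℕ) → Derivable (C [ generic s n ]')) → Derivable (∀′ s C)
  Derivable-∀I C h with readF C
  ... | WC , _ , dC with bounded (vars WC) (index WC)
  ... | n , below = generalize dC below (h n)

  ∀-mono : ∀ {s s'} (B : Form L⁺ (s ∷ [])) (B' : Form L⁺ (s' ∷ [])) →
           ((e' : Term L⁺ [] s') → Σ (Term L⁺ [] s) λ e → Derivable (B [ e ]' ⇒′ B' [ e' ]')) →
           Derivable (∀′ s B ⇒′ ∀′ s' B')
  ∀-mono {s} {s'} B B' h = Derivable-mp (∀-⇒-pull (∀′ s B) B') (Derivable-∀I C hC)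
    where
      C : Form L⁺ (s' ∷ [])
      C = weaken L⁺ (∀′ s B) ⇒′ B'
      hC : (n : ℕ) → Derivable (C [ generic s' n ]')
      hC n = subst Derivable (sym (cong (_⇒′ (B' [ generic s' n ]')) (Syn⁺.subF-sub0-there (generic s' n) (∀′ s B))))
                   (⇒-trans (∀-instance B (proj₁ (h (generic s' n)))) (proj₂ (h (generic s' n))))

  ∃-mono : ∀ {s s'} (B : Form L⁺ (s ∷ [])) (B' : Form L⁺ (s' ∷ [])) →
          ((e : Term L⁺ [] s) → Σ (Term L⁺ [] s') λ e' → Derivable (B [ e ]' ⇒′ B' [ e' ]')) →
          Derivable (∃′ s B ⇒′ ∃′ s' B')
  ∃-mono {s} {s'} B B' h = Derivable-mp (⇒-flip (∃-⇒-elim (∃′ s' B') B)) (Derivable-∀I C hC)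
    where
      C : Form L⁺ (s ∷ [])
      C = B ⇒′ weaken L⁺ (∃′ s' B')
      hC : (n : ℕ) → Derivable (C [ generic s n ]')
      hC n = subst Derivable (sym (cong ((B [ generic s n ]') ⇒′_) (Syn⁺.subF-sub0-there (generic s n) (∃′ s' B'))))
                   (⇒-trans (proj₂ (h (generic s n))) (∃-instance B' (proj₁ (h (generic s n)))))

  instances-correspond : ∀ {s s'} {S S₂ : Carrier → Set} {B : Form L⁺ (s ∷ [])} {B' : Form L⁺ (s' ∷ [])} →
         SameSet _≈_ S (Instances B) → SameSet _≈_ S₂ (Instances B') → SameSet _≈_ S S₂ →
         (e' : Term L⁺ [] s') → Σ (Term L⁺ [] s) λ t → (B' [ e' ]') ≈ (B [ t ]')
  instances-correspond {B' = B'} ssB ssB' SS e' with proj₂ ssB' (B' [ e' ]') (e' , ≈refl)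
  ... | y , S'y , a1 with proj₂ SS y S'y
  ... | z , Sz , a2 with proj₁ ssB z Sz
  ... | w , (t , a4) , a3 = t , ≈trans a1 (≈trans a2 (≈trans a3 a4))

  ∀̃-resp : ∀ {S S₂} (p : IsInstanceSet S) (q : IsInstanceSet S₂) → SameSet _≈_ S S₂ → ∀̃ S p ≈ ∀̃ S₂ q
  ∀̃-resp (s , B , ssB) (s' , B' , ssB') SS =
    ∀-mono B B' (map₂ proj₂ ∘ instances-correspond ssB ssB' SS) ,
    ∀-mono B' B (map₂ proj₂ ∘ instances-correspond ssB' ssB (SameSet-sym SS))

  ∃̃-resp : ∀ {S S₂} (p : IsInstanceSet S) (q : IsInstanceSet S₂) → SameSet _≈_ S S₂ → ∃̃ S p ≈ ∃̃ S₂ q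
  ∃̃-resp (s , B , ssB) (s' , B' , ssB') SS =
    ∃-mono B B' (map₂ proj₁ ∘ instances-correspond ssB' ssB (SameSet-sym SS)) ,
    ∃-mono B' B (map₂ proj₁ ∘ instances-correspond ssB ssB' SS)

  ∀̃-derivable : ∀ {S} (p : IsInstanceSet S) → ((x : Carrier) → S x → Derivable x) → Derivable (∀̃ S p)
  ∀̃-derivable (s , B , ss) h = Derivable-∀I B hh
    where
      hh : (n : ℕ) → Derivable (B [ generic s n ]')
      hh n with proj₂ ss (B [ generic s n ]') (generic s n , ≈refl)
      ... | y , Sy , a = Derivable-resp (≈sym a) (h y Sy)

  ∀̃-elim : ∀ {a S} (p : IsInstanceSet S) → S a → Derivable (∀̃ S p ⇒′ a)
  ∀̃-elim {a} (s , B , ss) Sa with proj₁ ss a Sa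
  ... | y , (t , yBt) , ay = ⇒-trans (∀-instance B t) (proj₂ (≈trans ay yBt))

  ∃̃-intro : ∀ {a S} (p : IsInstanceSet S) → S a → Derivable (a ⇒′ ∃̃ S p)
  ∃̃-intro {a} (s , B , ss) Sa with proj₁ ss a Sa
  ... | y , (t , yBt) , ay = ⇒-trans (proj₁ (≈trans ay yBt)) (∃-instance B t)

  SameSet-image : ∀ {s} {S : Carrier → Set} {B : Form L⁺ (s ∷ [])} (f : Carrier → Carrier) (K : Form L⁺ (s ∷ []) → Form L⁺ (s ∷ [])) →
          (∀ t F → (K F) [ t ]' ≡ f (F [ t ]')) → (∀ {x y} → x ≈ y → f x ≈ f y) →
          SameSet _≈_ S (Instances B) → SameSet _≈_ (image _≈_ f S) (Instances (K B))
  SameSet-image {S = S} {B} f K eqK fc (ssf , ssb) = fw , bw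
    where
      fw : (x : Carrier) → image _≈_ f S x → ∃ λ y → Instances (K B) y × (x ≈ y)
      fw x (e , Se , xfe) with ssf e Se
      ... | y , (t , yBt) , ey = x , (t , subst (x ≈_) (sym (eqK t B)) (≈trans xfe (fc (≈trans ey yBt)))) , ≈refl
      bw : (z : Carrier) → Instances (K B) z → ∃ λ x → image _≈_ f S x × (z ≈ x)
      bw z (t , zK) with ssb (B [ t ]') (t , ≈refl)
      ... | e , Se , Bte = f e , (e , Se , ≈refl) , ≈trans (subst (z ≈_) (eqK t B) zK) (fc Bte)

  IsInstanceSet-⇒ʳ : ∀ a {S} → IsInstanceSet S → IsInstanceSet (image _≈_ (λ e → a ⇒′ e) S)
  IsInstanceSet-⇒ʳ a (s , B , ss) = s , (weaken L⁺ a ⇒′ B) ,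
    SameSet-image (λ e → a ⇒′ e) (λ F → weaken L⁺ a ⇒′ F) (λ t F → cong (_⇒′ (F [ t ]')) (Syn⁺.subF-sub0-there t a)) (λ xy → ⇒cong ≈refl xy) ss

  IsInstanceSet-⇒ˡ : ∀ a {S} → IsInstanceSet S → IsInstanceSet (image _≈_ (λ e → e ⇒′ a) S)
  IsInstanceSet-⇒ˡ a (s , B , ss) = s , (B ⇒′ weaken L⁺ a) ,
    SameSet-image (λ e → e ⇒′ a) (λ F → F ⇒′ weaken L⁺ a) (λ t F → cong ((F [ t ]') ⇒′_) (Syn⁺.subF-sub0-there t a)) (λ xy → ⇒cong xy ≈refl) ss

  ∀̃-⇒-pull : ∀ {a S} (p : IsInstanceSet S) → Derivable (∀̃ (image _≈_ (λ e → a ⇒′ e) S) (IsInstanceSet-⇒ʳ a p) ⇒′ a ⇒′ ∀̃ S p)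
  ∀̃-⇒-pull {a} (s , B , ss) = ∀-⇒-pull a B

  ∃̃-⇒-elim : ∀ {a S} (q : IsInstanceSet S) → Derivable (∃̃ S q ⇒′ ∀̃ (image _≈_ (λ e → e ⇒′ a) S) (IsInstanceSet-⇒ˡ a q) ⇒′ a)
  ∃̃-⇒-elim {a} (s , B , ss) = ∃-⇒-elim a B

  𝔹 : TVA
  𝔹 = record
    { Carrier = Carrier
    ; _≈_ = _≈_
    ; ≈-isEquivalence = record { refl = ≈refl ; sym = ≈sym ; trans = ≈trans }
    ; Pos = Derivable
    ; 𝒜 = IsInstanceSet
    ; ℰ = IsInstanceSet
    ; ⊤̃ = ⊤′
    ; ⊥̃ = ⊥′
    ; _⇒̃_ = _⇒′_
    ; _∧̃_ = _∧′_
    ; _∨̃_ = _∨′_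
    ; ∀̃ = ∀̃
    ; ∃̃ = ∃̃
    ; Pos-resp = Derivable-resp
    ; ⇒̃-cong = ⇒cong
    ; ∧̃-cong = ∧cong
    ; ∨̃-cong = ∨cong
    ; 𝒜-resp = IsInstanceSet-resp
    ; ℰ-resp = IsInstanceSet-resp
    ; ∀̃-resp = ∀̃-resp
    ; ∃̃-resp = ∃̃-resp
    ; c1 = Derivable-mp
    ; c2 = λ {a} {b} → schema-derivable (p₀ s⇒ p₁ s⇒ p₀) (λ Fs → lam (lam hyp₁)) (v2 a b)
    ; c3 = λ {a} {b} {c} → schema-derivable ((p₀ s⇒ p₁ s⇒ p₂) s⇒ (p₀ s⇒ p₁) s⇒ p₀ s⇒ p₂)
             (λ Fs → lam (lam (lam (app⇒ (app⇒ hyp₂ hyp₀) (app⇒ hyp₁ hyp₀))))) (v3 a b c)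
    ; c4 = schema-derivable {0} s⊤ (λ Fs → ⊤I ε) (λ ())
    ; c5 = λ {a} → schema-derivable (s⊥ s⇒ p₀) (λ Fs → lam (⊥E hyp₀ ε)) (v1 a)
    ; c6 = λ {a} {b} → schema-derivable (p₀ s⇒ p₁ s⇒ (p₀ s∧ p₁)) (λ Fs → lam (lam (∧I hyp₁ hyp₀ ε))) (v2 a b)
    ; c7 = λ {a} {b} → schema-derivable ((p₀ s∧ p₁) s⇒ p₀) (λ Fs → lam (∧E₁ hyp₀ ε)) (v2 a b)
    ; c8 = λ {a} {b} → schema-derivable ((p₀ s∧ p₁) s⇒ p₁) (λ Fs → lam (∧E₂ hyp₀ ε)) (v2 a b)
    ; c9 = λ {a} {b} → schema-derivable (p₀ s⇒ (p₀ s∨ p₁)) (λ Fs → lam (∨I₁ hyp₀ ε)) (v2 a b)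
    ; c10 = λ {a} {b} → schema-derivable (p₁ s⇒ (p₀ s∨ p₁)) (λ Fs → lam (∨I₂ hyp₀ ε)) (v2 a b)
    ; c11 = λ {a} {b} {c} → schema-derivable ((p₀ s∨ p₁) s⇒ (p₀ s⇒ p₂) s⇒ (p₁ s⇒ p₂) s⇒ p₂)
              (λ Fs → lam (lam (lam (∨E hyp₂ ε (app⇒ hyp₂ hyp₀) (app⇒ hyp₁ hyp₀))))) (v3 a b c)
    ; c12a = IsInstanceSet-⇒ʳ
    ; c12b = IsInstanceSet-⇒ˡ
    ; c13 = ∀̃-derivable
    ; c14 = ∀̃-⇒-pull
    ; c15 = ∀̃-elim
    ; c16 = ∃̃-intro
    ; c17 = ∃̃-⇒-elim
    }



module CanonicalModel (L : Signature) (T : Theory L) (Γ : List (Signature.Sort L)) where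
  open Signature L
  open Theory T renaming (rewriting to R)
  open Syntax L
  open Conversion L R
  open Derivations L T
  open ExtendedLanguage L Γ
  open Readings L Γ
  open Derivability L T Γ
  open LindenbaumAlgebra L T Γ
  open Naming
  open Mor

  Dom : Sort → Set
  Dom s = Term L⁺ [] s

  toArgs : ∀ {ss} → All Dom ss → Args L⁺ [] ss
  toArgs [] = []
  toArgs (x ∷ xs) = x ∷ toArgs xs

  ReadConvT : ∀ {s} → Dom s → Dom s → Set
  ReadConvT {s} e e' = Σ Naming λ W → Σ (Term L (ctx W) s) λ te → Σ (Term L (ctx W) s) λ te' →
                   TrT W [] e te × TrT W [] e' te' × ConvT L R te te'

  ReadConvA : ∀ {ss} → Args L⁺ [] ss → Args L⁺ [] ss → Set
  ReadConvA {ss} e e' = Σ Naming λ W → Σ (Args L (ctx W) ss) λ te → Σ (Args L (ctx W) ss) λ te' →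
                   TrA W [] e te × TrA W [] e' te' × ConvA te te'

  _≈ᴰ_ : ∀ {s} → Dom s → Dom s → Set
  _≈ᴰ_ = EqClosure ReadConvT

  ReadConvA-head : ∀ {s ss} (as : Args L⁺ [] ss) {x y : Term L⁺ [] s} → ReadConvT x y → ReadConvA (x ∷ as) (y ∷ as)
  ReadConvA-head as (W₁ , _ , _ , d , d' , c) with readA as
  ... | W₂ , us , ds =
    W₁ ⊕ W₂ , _ , _ , TrT-mor inl d ∷ TrA-mor inr ds , TrT-mor inl d' ∷ TrA-mor inr ds ,
    gmap (_∷ renA L (morRen [] inr) us) head (ConvT-ren (morRen [] inl) c)
    where
      inl : Mor W₁ (W₁ ⊕ W₂)
      inl = inlMor
      inr : Mor W₂ (W₁ ⊕ W₂)
      inr = inrMor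

  ReadConvA-tail : ∀ {s ss} (x : Term L⁺ [] s) {as as' : Args L⁺ [] ss} → ReadConvA as as' → ReadConvA (x ∷ as) (x ∷ as')
  ReadConvA-tail x (W₁ , _ , _ , d , d' , c) with readT x
  ... | W₂ , u , dx =
    W₁ ⊕ W₂ , _ , _ , TrT-mor inr dx ∷ TrA-mor inl d , TrT-mor inr dx ∷ TrA-mor inl d' ,
    gmap (renT L (morRen [] inr) u ∷_) tail (ConvA-ren (morRen [] inl) c)
    where
      inl : Mor W₁ (W₁ ⊕ W₂)
      inl = inlMor
      inr : Mor W₂ (W₁ ⊕ W₂)
      inr = inrMor

  toArgs-cong : ∀ {ss} {xs ys : All Dom ss} → AllPW _≈ᴰ_ xs ys → EqClosure ReadConvA (toArgs xs) (toArgs ys)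
  toArgs-cong [] = ε
  toArgs-cong (_∷_ {y = y} {xs' = xs'} p ps) =
    gmap (_∷ toArgs xs') (ReadConvA-head (toArgs xs')) p ◅◅ gmap (y ∷_) (ReadConvA-tail y) (toArgs-cong ps)

  ReadConvT-fun : ∀ f {as as' : Args L⁺ [] (funArity f)} → ReadConvA as as' → ReadConvT (app (inj₁ f) as) (app (inj₁ f) as')
  ReadConvT-fun f (W , te , te' , d , d' , c) = W , app f te , app f te' , tfun f d , tfun f d' , gmap (app f) (app f) c

  atom-≈-step : ∀ P {as as' : Args L⁺ [] (predArity P)} → ReadConvA as as' → atom P as ≈ atom P as'
  atom-≈-step P (W , te , te' , d , d' , c) =
    (W , _ , t⇒ (tatom P d) (tatom P d') , lam (ax (here refl) (gmap (atom P) (atom P) c))) ,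
    (W , _ , t⇒ (tatom P d') (tatom P d) , lam (ax (here refl) (gmap (atom P) (atom P) (symmetric (StepA L R) c))))

  atom-≈ : ∀ P {as as' : Args L⁺ [] (predArity P)} → EqClosure ReadConvA as as' → atom P as ≈ atom P as'
  atom-≈ P ε = ≈refl
  atom-≈ P (fwd b ◅ rest) = ≈trans (atom-≈-step P b) (atom-≈ P rest)
  atom-≈ P (bwd b ◅ rest) = ≈trans (≈sym (atom-≈-step P b)) (atom-≈ P rest)

  M : Structure L 𝔹
  M = record
    { Dom = Dom
    ; _≈ᴰ_ = _≈ᴰ_
    ; ≈ᴰ-isEquivalence = EqClosure-isEquivalence ReadConvT
    ; inhabited = λ s → generic s 0
    ; fun = λ f xs → app (inj₁ f) (toArgs xs)
    ; pred = λ P xs → atom P (toArgs xs)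
    ; fun-cong = λ f ps → gmap (app (inj₁ f)) (ReadConvT-fun f) (toArgs-cong ps)
    ; pred-cong = λ P ps → atom-≈ P (toArgs-cong ps)
    }

  mutual
    embT : ∀ {D s} → Term L D s → Term L⁺ D s
    embT (var x) = var (toVar⁺ x)
    embT (app f ts) = app (inj₁ f) (embA ts)

    embA : ∀ {D ss} → Args L D ss → Args L⁺ D ss
    embA [] = []
    embA (t ∷ ts) = embT t ∷ embA ts

  embF : ∀ {D} → Form L D → Form L⁺ D
  embF (atom P ts) = atom P (embA ts)
  embF ⊤′ = ⊤′
  embF ⊥′ = ⊥′
  embF (A ⇒′ B) = embF A ⇒′ embF B
  embF (A ∧′ B) = embF A ∧′ embF B
  embF (A ∨′ B) = embF A ∨′ embF B
  embF (∀′ s A) = ∀′ s (embF A)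
  embF (∃′ s A) = ∃′ s (embF A)

  φ̂ : ∀ {G} → All Dom G → Subst L⁺ G []
  φ̂ φ x = lookupV L M (toVar x) φ

  mutual
    ⟦⟧t-canonical : ∀ {G s} (t : Term L G s) (φ : All Dom G) → ⟦_⟧t L M t φ ≡ subT L⁺ (φ̂ φ) (embT t)
    ⟦⟧t-canonical (var x) φ = cong (λ z → lookupV L M z φ) (sym (toVar-toVar⁺ x))
    ⟦⟧t-canonical (app f ts) φ = cong (app (inj₁ f)) (⟦⟧a-canonical ts φ)

    ⟦⟧a-canonical : ∀ {G ss} (ts : Args L G ss) (φ : All Dom G) → toArgs (⟦_⟧a L M ts φ) ≡ subA L⁺ (φ̂ φ) (embA ts)
    ⟦⟧a-canonical [] φ = refl
    ⟦⟧a-canonical (t ∷ ts) φ = cong₂ _∷_ (⟦⟧t-canonical t φ) (⟦⟧a-canonical ts φ)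

  mutual
    defined : ∀ {G} (A : Form L G) (φ : All Dom G) → Defined L M A φ
    defined (atom P ts) φ = tt
    defined ⊤′ φ = tt
    defined ⊥′ φ = tt
    defined (A ⇒′ B) φ = defined A φ , defined B φ
    defined (A ∧′ B) φ = defined A φ , defined B φ
    defined (A ∨′ B) φ = defined A φ , defined B φ
    defined (∀′ s A) φ = (λ e → defined A (e ∷ φ)) , (s , subF L⁺ (liftSub L⁺ (φ̂ φ)) (embF A) , instanceSet-canonical A φ)
    defined (∃′ s A) φ = (λ e → defined A (e ∷ φ)) , (s , subF L⁺ (liftSub L⁺ (φ̂ φ)) (embF A) , instanceSet-canonical A φ)

    instanceSet-canonical : ∀ {G s} (A : Form L (s ∷ G)) (φ : All Dom G) →
          SameSet _≈_ (λ b → ∃ λ (e : Dom s) → b ≈ ⟦_⟧ L M A (e ∷ φ) (defined A (e ∷ φ)))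
                      (Instances (subF L⁺ (liftSub L⁺ (φ̂ φ)) (embF A)))
    instanceSet-canonical A φ = (λ { b (e , be) → b , (e , subst (b ≈_) (⟦⟧-instance A φ e) be) , ≈refl }) ,
              (λ { b (e , be) → b , (e , subst (b ≈_) (sym (⟦⟧-instance A φ e)) be) , ≈refl })

    ⟦⟧-instance : ∀ {G s} (A : Form L (s ∷ G)) (φ : All Dom G) (e : Dom s) →
          ⟦_⟧ L M A (e ∷ φ) (defined A (e ∷ φ)) ≡ (subF L⁺ (liftSub L⁺ (φ̂ φ)) (embF A)) [ e ]'
    ⟦⟧-instance {G} {s} A φ e =
      trans (⟦⟧-canonical A (e ∷ φ)) (sym (Syn⁺.subF-subF (sub0 L⁺ e) (liftSub L⁺ (φ̂ φ)) (φ̂ (e ∷ φ)) onVar (embF A)))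
      where
        onVar : ∀ {s'} (x : Var L⁺ (s ∷ G) s') → subT L⁺ (sub0 L⁺ e) (liftSub L⁺ (φ̂ φ) x) ≡ φ̂ (e ∷ φ) x
        onVar here = refl
        onVar (there x) = Syn⁺.subT-sub0-there e (φ̂ φ x)

    ⟦⟧-canonical : ∀ {G} (A : Form L G) (φ : All Dom G) → ⟦_⟧ L M A φ (defined A φ) ≡ subF L⁺ (φ̂ φ) (embF A)
    ⟦⟧-canonical (atom P ts) φ = cong (atom P) (⟦⟧a-canonical ts φ)
    ⟦⟧-canonical ⊤′ φ = refl
    ⟦⟧-canonical ⊥′ φ = refl
    ⟦⟧-canonical (A ⇒′ B) φ = cong₂ _⇒′_ (⟦⟧-canonical A φ) (⟦⟧-canonical B φ)
    ⟦⟧-canonical (A ∧′ B) φ = cong₂ _∧′_ (⟦⟧-canonical A φ) (⟦⟧-canonical B φ)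
    ⟦⟧-canonical (A ∨′ B) φ = cong₂ _∨′_ (⟦⟧-canonical A φ) (⟦⟧-canonical B φ)
    ⟦⟧-canonical (∀′ s A) φ = refl
    ⟦⟧-canonical (∃′ s A) φ = refl

  ⟦⟧-irrelevant : ∀ {G} (A : Form L G) (φ : All Dom G) (d : Defined L M A φ) → ⟦_⟧ L M A φ d ≈ ⟦_⟧ L M A φ (defined A φ)
  ⟦⟧-irrelevant (atom P ts) φ d = ≈refl
  ⟦⟧-irrelevant ⊤′ φ d = ≈refl
  ⟦⟧-irrelevant ⊥′ φ d = ≈refl
  ⟦⟧-irrelevant (A ⇒′ B) φ (d , d') = ⇒cong (⟦⟧-irrelevant A φ d) (⟦⟧-irrelevant B φ d')
  ⟦⟧-irrelevant (A ∧′ B) φ (d , d') = ∧cong (⟦⟧-irrelevant A φ d) (⟦⟧-irrelevant B φ d')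
  ⟦⟧-irrelevant (A ∨′ B) φ (d , d') = ∨cong (⟦⟧-irrelevant A φ d) (⟦⟧-irrelevant B φ d')
  ⟦⟧-irrelevant (∀′ s A) φ (d , p) = ∀̃-resp p (proj₂ (defined (∀′ s A) φ))
    ((λ { b (e , be) → b , (e , ≈trans be (⟦⟧-irrelevant A (e ∷ φ) (d e))) , ≈refl }) ,
     (λ { b (e , be) → b , (e , ≈trans be (≈sym (⟦⟧-irrelevant A (e ∷ φ) (d e)))) , ≈refl }))
  ⟦⟧-irrelevant (∃′ s A) φ (d , p) = ∃̃-resp p (proj₂ (defined (∃′ s A) φ))
    ((λ { b (e , be) → b , (e , ≈trans be (⟦⟧-irrelevant A (e ∷ φ) (d e))) , ≈refl }) ,
     (λ { b (e , be) → b , (e , ≈trans be (≈sym (⟦⟧-irrelevant A (e ∷ φ) (d e)))) , ≈refl }))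

  readAssignment : ∀ {G} (φ : All Dom G) → Σ Naming λ W → Σ (Subst L G (ctx W)) λ τ →
              ∀ {s} (x : Var L G s) → TrT W [] (lookupV L M x φ) (τ x)
  readAssignment [] = emptyNaming , (λ ()) , (λ ())
  readAssignment (e ∷ φ) with readT e | readAssignment φ
  ... | W₁ , u , de | W₂ , τ , reads = W₁ ⊕ W₂ , τ' , reads'
    where
      τ' : Subst L _ (ctx (W₁ ⊕ W₂))
      τ' here = renT L (morRen [] (inlMor {W₁} {W₂})) u
      τ' (there x) = renT L (morRen [] (inrMor {W₁} {W₂})) (τ x)
      reads' : ∀ {s} (x : Var L _ s) → TrT (W₁ ⊕ W₂) [] (lookupV L M x (e ∷ φ)) (τ' x)
      reads' here = TrT-mor (inlMor {W₁} {W₂}) de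
      reads' (there x) = TrT-mor (inrMor {W₁} {W₂}) (reads x)

  sumSub : ∀ {G s} (W : Naming) (τ : Subst L G (ctx W)) → Var L G s ⊎ Var L (ctx W) s → Term L (ctx W) s
  sumSub W τ (inj₁ x) = τ x
  sumSub W τ (inj₂ y) = var y

  splitSub : ∀ {G} (W : Naming) (τ : Subst L G (ctx W)) → Subst L (G ++ ctx W) (ctx W)
  splitSub {G} W τ v = sumSub W τ (splitVar G v)

  mutual
    TrT-embed : ∀ {W D s} (r : Ren L D (D ++ ctx W)) → (∀ {s} (x : Var L D s) → r x ≡ extendRight L x) →
             (t : Term L D s) → TrT W D (embT t) (renT L r t)
    TrT-embed r h (var x) =
      subst (λ z → TrT _ _ (var (toVar⁺ x)) (var z)) (trans (cong (extendRight L) (toVar-toVar⁺ x)) (sym (h x))) (tvar (toVar⁺ x))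
    TrT-embed r h (app f ts) = tfun f (TrA-embed r h ts)

    TrA-embed : ∀ {W D ss} (r : Ren L D (D ++ ctx W)) → (∀ {s} (x : Var L D s) → r x ≡ extendRight L x) →
             (ts : Args L D ss) → TrA W D (embA ts) (renA L r ts)
    TrA-embed r h [] = []
    TrA-embed r h (t ∷ ts) = TrT-embed r h t ∷ TrA-embed r h ts

  liftRen-extendRight : ∀ {W D s} (r : Ren L D (D ++ ctx W)) → (∀ {s} (x : Var L D s) → r x ≡ extendRight L x) →
          ∀ {s'} (x : Var L (s ∷ D) s') → liftRen L r x ≡ extendRight L x
  liftRen-extendRight r h here = refl
  liftRen-extendRight r h (there x) = cong there (h x)

  TrF-embed : ∀ {W D} (r : Ren L D (D ++ ctx W)) → (∀ {s} (x : Var L D s) → r x ≡ extendRight L x) →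
           (A : Form L D) → TrF W D (embF A) (renF L r A)
  TrF-embed r h (atom P ts) = tatom P (TrA-embed r h ts)
  TrF-embed r h ⊤′ = t⊤
  TrF-embed r h ⊥′ = t⊥
  TrF-embed r h (A ⇒′ B) = t⇒ (TrF-embed r h A) (TrF-embed r h B)
  TrF-embed r h (A ∧′ B) = t∧ (TrF-embed r h A) (TrF-embed r h B)
  TrF-embed r h (A ∨′ B) = t∨ (TrF-embed r h A) (TrF-embed r h B)
  TrF-embed {W} r h (∀′ s A) = t∀ s (TrF-embed (liftRen L r) (liftRen-extendRight {W} r h) A)
  TrF-embed {W} r h (∃′ s A) = t∃ s (TrF-embed (liftRen L r) (liftRen-extendRight {W} r h) A)

  ImplementsSub-assignment : ∀ {G W} (φ : All Dom G) (τ : Subst L G (ctx W)) →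
           (∀ {s} (x : Var L G s) → TrT W [] (lookupV L M x φ) (τ x)) → ImplementsSub W (φ̂ φ) (splitSub W τ)
  ImplementsSub.sub-bound (ImplementsSub-assignment {G} {W} φ τ reads) x =
    subst (TrT W [] (φ̂ φ x)) (sym (cong (sumSub W τ) (splitVar-extendRight G (toVar x)))) (reads (toVar x))
  ImplementsSub.sub-ctx (ImplementsSub-assignment {G} {W} φ τ reads) y = cong (sumSub W τ) (splitVar-shiftBy G y)

  module _ {G W} (φ : All Dom G) (τ : Subst L G (ctx W)) (reads : ∀ {s} (x : Var L G s) → TrT W [] (lookupV L M x φ) (τ x)) where
    private
      splitSub-extendRight : ∀ {s} (x : Var L G s) → splitSub W τ (extendRight L x) ≡ τ x
      splitSub-extendRight x = cong (sumSub W τ) (splitVar-extendRight G x)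

    TrT-⟦⟧t : ∀ {s} (t : Term L G s) → TrT W [] (⟦_⟧t L M t φ) (subT L τ t)
    TrT-⟦⟧t t =
      subst₂ (TrT W []) (sym (⟦⟧t-canonical t φ)) (subT-renT (splitSub W τ) (extendRight L) τ splitSub-extendRight t)
             (TrT-sub (ImplementsSub-assignment φ τ reads) (TrT-embed (extendRight L) (λ x → refl) t))

    TrF-⟦⟧ : (A : Form L G) → TrF W [] (⟦_⟧ L M A φ (defined A φ)) (subF L τ A)
    TrF-⟦⟧ A =
      subst₂ (TrF W []) (sym (⟦⟧-canonical A φ)) (subF-renF (splitSub W τ) (extendRight L) τ splitSub-extendRight A)
             (TrF-sub (ImplementsSub-assignment φ τ reads) (TrF-embed (extendRight L) (λ x → refl) A))

  axioms-valid : (A : Form L []) → Axiom A → Valid L M A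
  axioms-valid A axA φ with readAssignment φ
  ... | W , τ , reads =
    defined A φ , W , subF L τ A , TrF-⟦⟧ φ τ reads A , thy axA (≡⇒ConvF (renF≗subF _ τ (λ ()) A))

  ConvT⇒≈ᴰ : ∀ {G s} {t u : Term L G s} → ConvT L R t u → ∀ φ → ⟦_⟧t L M t φ ≈ᴰ ⟦_⟧t L M u φ
  ConvT⇒≈ᴰ {t = t} {u} c φ with readAssignment φ
  ... | W , τ , reads = fwd (W , subT L τ t , subT L τ u , TrT-⟦⟧t φ τ reads t , TrT-⟦⟧t φ τ reads u , ConvT-sub τ c) ◅ ε

  ConvF⇒≈ : ∀ {G} {A B : Form L G} → ConvF L R A B → ∀ φ →
            Σ (Defined L M A φ) λ d → Σ (Defined L M B φ) λ d' → ⟦_⟧ L M A φ d ≈ ⟦_⟧ L M B φ d'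
  ConvF⇒≈ {A = A} {B} c φ with readAssignment φ
  ... | W , τ , reads =
    defined A φ , defined B φ ,
    (W , _ , t⇒ (TrF-⟦⟧ φ τ reads A) (TrF-⟦⟧ φ τ reads B) , lam (ax (here refl) (ConvF-sub τ c))) ,
    (W , _ , t⇒ (TrF-⟦⟧ φ τ reads B) (TrF-⟦⟧ φ τ reads A) , lam (ax (here refl) (symmetric (StepF L R) (ConvF-sub τ c))))

  isModel : IsModel L M T
  isModel = record { axiomsValid = axioms-valid ; termConv = ConvT⇒≈ᴰ ; formConv = ConvF⇒≈ }

  tabulateAll : ∀ {G} → (∀ {s} → Var L G s → Dom s) → All Dom G
  tabulateAll {[]} f = []
  tabulateAll {s ∷ G} f = f here ∷ tabulateAll (λ x → f (there x))

  lookupV-tabulateAll : ∀ {G s} (f : ∀ {s} → Var L G s → Dom s) (x : Var L G s) → lookupV L M x (tabulateAll f) ≡ f x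
  lookupV-tabulateAll f here = refl
  lookupV-tabulateAll f (there x) = lookupV-tabulateAll (λ y → f (there y)) x

  φ₀ : All Dom Γ
  φ₀ = tabulateAll param

  TrF-⟦⟧-φ₀ : (A : Form L Γ) → TrF emptyNaming [] (⟦_⟧ L M A φ₀ (defined A φ₀)) (renF L (extendRight L) A)
  TrF-⟦⟧-φ₀ A = subst (TrF emptyNaming [] _) (sym (renF≗subF (extendRight L) _ (λ x → refl) A)) (TrF-⟦⟧ φ₀ _ reads A)
    where
      reads : ∀ {s} (x : Var L Γ s) → TrT emptyNaming [] (lookupV L M x φ₀) (var (extendRight L x))
      reads x = subst (λ e → TrT emptyNaming [] e (var (extendRight L x))) (sym (lookupV-tabulateAll param x)) (tparam x)

  provable-of-derivable : (A : Form L Γ) → Derivable (⟦_⟧ L M A φ₀ (defined A φ₀)) → Provable L T A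
  provable-of-derivable A (W , F , d , D) with merge d (TrF-⟦⟧-φ₀ A)
  ... | W' , m , m₀ , agree = vars W' , subst (Deriv L T (Γ ++ vars W') []) (trans agree unmoved) (Deriv-ren (morRen [] m) D)
    where
      unmoved : renF L (morRen [] m₀) (renF L (extendRight L) A) ≡ renF L (extendRight L) A
      unmoved = renF-renF _ _ _ (liftRenBy-extendRight Γ (vmap m₀)) A

  provable-of-valid : (A : Form L Γ) → Valid L M A → Provable L T A
  provable-of-valid A valid with valid φ₀
  ... | d , derivable = provable-of-derivable A (Derivable-resp (⟦⟧-irrelevant A φ₀ d) derivable)

mainTheorem4 : (L : Signature) (T : Theory L) {Γ : List (Signature.Sort L)} (A : Form L Γ) →
    ((𝔹 : TVA) (M : Structure L 𝔹) → IsModel L M T →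
    ((φ : All (Structure.Dom M) Γ) → Defined L M A φ) → Valid L M A) →
    Provable L T A
mainTheorem4 L T {Γ} A valid = provable-of-valid A (valid 𝔹 M isModel (defined A))
  where
    open LindenbaumAlgebra L T Γ using (𝔹)
    open CanonicalModel L T Γ
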